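{- Let $p$ be a prime, $n\ge 1$, $q=p^n$, and let $\gamma\in\mathbb{F}_q^*$ have multiplicative order $T$; put $G=\langle\gamma\rangle$. Let $(\beta_1,\ldots,\beta_n)$ be an ordered basis of $\mathbb{F}_q$ over $\mathbb{F}_p$ and let $P:G\to\mathbb{F}_q$ be the map $P(\gamma^x)=\xi_x$ for $x=0,1,\ldots,T-1$. Let $m$ be an integer with $0\le m\le T$ and $F:\mathbb{F}_q\to\mathbb{F}_q$ a map with $F(\zeta)=P(\zeta)$ for all but at most $m$ elements $\zeta\in G$. Suppose there exist an $\mathbb{F}_p$-linear subspace $U\le\mathbb{F}_q$ of codimension $k$, a linearised polynomial $M\in\mathbb{F}_q[X]$ and constants $a_V\in\mathbb{F}_q$ indexed by the cosets $V$ of $U$, such that $F(\zeta)=M(\zeta)+a_{U+\zeta}$ for all $\zeta\in\mathbb{F}_q$. Assume that $\gamma-1\in rG=\{\sum_{i=1}^r\zeta_i:(\zeta_1,\ldots,\zeta_r)\in G^r\}$ for an integer $r$ coprime to $p$, and that $m<\frac{T-1}{r+2}$. Then $$p^k\ge\left(\frac{T-(r+2)m-1}{rn}\right)^{1/(r+1)}.$$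
   Context: A linearised polynomial over $\mathbb{F}_q$ is one of the form $\sum_{j=0}^{n-1}c_jX^{p^j}$, $c_j\in\mathbb{F}_q$. For an integer $0\le x\le q-1$ with base-$p$ expansion $x=x_1+x_2p+\cdots+x_np^{n-1}$, $0\le x_i<p$, one sets $\xi_x=x_1\beta_1+\cdots+x_n\beta_n\in\mathbb{F}_q$. -}

module Defs where

open import Level using (0ℓ)
open import Algebra.Bundles using (CommutativeRing; Semiring)
open import Data.Nat as ℕ using (ℕ; NonZero)
open import Data.Nat.DivMod using (_/_; _%_)
open import Data.Fin as Fin using (Fin; toℕ)
open import Data.Unit using (⊤)
open import Data.Product using (Σ; ∃; _×_; _,_)
open import Data.Vec.Functional using (Vector)
open import Data.List using (List; length; filter; upTo)
open import Relation.Binary.Definitions using (Decidable)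
open import Relation.Binary.PropositionalEquality using (_≡_)
open import Relation.Nullary using (¬_)
open import Relation.Nullary using (¬?)

record IsDecField (R : CommutativeRing 0ℓ 0ℓ) : Set where
  open CommutativeRing R
  field
    _≟_     : Decidable _≈_
    1≉0     : ¬ (1# ≈ 0#)
    inverse : ∀ x → ¬ (x ≈ 0#) → ∃ λ y → x * y ≈ 1#

module FieldDefs (R : CommutativeRing 0ℓ 0ℓ) where
  open CommutativeRing R renaming (Carrier to A)
  open import Algebra.Definitions.RawSemiring (Semiring.rawSemiring semiring)
    using (sum; _^_) renaming (_×_ to _·_)

  lin : ∀ {p d} → (Fin d → Fin p) → Vector A d → A
  lin c v = sum (λ i → toℕ (c i) · v i)

  IsBasisOf : (p : ℕ) → ∀ {d} → (A → Set) → Vector A d → Set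
  IsBasisOf p {d} U v =
      (∀ i → U (v i))
    × (∀ (c c′ : Fin d → Fin p) → lin c v ≈ lin c′ v → c ≡ c′)
    × (∀ z → U z → ∃ λ (c : Fin d → Fin p) → lin c v ≈ z)

  IsSubspace : (p : ℕ) → (A → Set) → Set
  IsSubspace p U =
      (∀ {z z′} → z ≈ z′ → U z → U z′)
    × U 0#
    × (∀ {z z′} → U z → U z′ → U (z + z′))
    × (∀ (c : Fin p) {z} → U z → U (toℕ c · z))

  HasCodim : (p n k : ℕ) → (A → Set) → Set
  HasCodim p n k U =
    Σ ℕ λ d → (d ℕ.+ k ≡ n) × Σ (Vector A d) λ u → IsBasisOf p U u

  digit : (p : ℕ) → .{{NonZero p}} → ∀ {n} → ℕ → Fin n → ℕ
  digit p x Fin.zero    = x % p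
  digit p x (Fin.suc i) = digit p (x / p) i

  -- ξ_x = x_1 β_1 + ⋯ + x_n β_n  where x = x_1 + x_2 p + ⋯ + x_n p^(n-1)
  ξ : (p : ℕ) → .{{NonZero p}} → ∀ {n} → Vector A n → ℕ → A
  ξ p β x = sum (λ i → digit p x i · β i)

  HasChar : ℕ → Set
  HasChar p = p · 1# ≈ 0#

  IsBasis : (p : ℕ) → ∀ {n} → Vector A n → Set
  IsBasis p β = IsBasisOf p (λ _ → ⊤) β

  linearised : (p : ℕ) → ∀ {n} → Vector A n → A → A
  linearised p c z = sum (λ j → c j * z ^ (p ℕ.^ toℕ j))

  HasOrder : A → ℕ → Set
  HasOrder γ T = (1 ℕ.≤ T) × (γ ^ T ≈ 1#) × (∀ t → 1 ℕ.≤ t → t ℕ.< T → ¬ (γ ^ t ≈ 1#))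

  InSumset : (r : ℕ) → (γ : A) → (T : ℕ) → A → Set
  InSumset r γ T y = ∃ λ (e : Fin r → Fin T) → y ≈ sum (λ i → γ ^ toℕ (e i))

  disagreements : (Decidable _≈_) → (p : ℕ) → .{{NonZero p}} → ∀ {n} →
                  Vector A n → (A → A) → A → ℕ → ℕ
  disagreements _≟_ p β F γ T =
    length (filter (λ x → ¬? (F (γ ^ x) ≟ ξ p β x)) (upTo T))

module Submission where

-- Call x < T − 1 good when F agrees with P at γ^x, γ^(x+1) and at the points
-- γ^(y_i) = γ^x γ^(e_i), where γ − 1 = Σ_i γ^(e_i); all but (r + 2) m values of x are
-- good. Since M is additive and a is constant on cosets of U, for good x the relation
-- γ^(x+1) = γ^x + Σ_i γ^(y_i) makes ξ_(x+1) − ξ_x − Σ_i ξ_(y_i) depend only on the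
-- cosets of γ^x and of the γ^(y_i). Two good x ≤ x′ with the same cosets and the same
-- number of wrap-arounds x + e_i ≥ T have y_i′ − y_i = x′ − x, and comparing their
-- ξ-identities digit by digit from the bottom gives r (x′ − x) / p^j ≡ 0 (mod p) at every
-- place j, so x = x′ as r is prime to p. Hence there are at most (r + 1) p^(k(r+1)) good
-- x, and r + 1 ≤ r n when n ≥ 2. For n = 1 the case k = 1 is trivial as T ≤ p; for k = 0
-- the map a is constant on G, so F(γ^(x+1)) − F(γ^x) = c γ^x (γ − 1) equals the nonzero
-- constant β_1 for at most one x.

open import Defs
open import Level using (0ℓ)
open import Algebra.Bundles using (CommutativeRing)
open import Data.Nat as ℕ using (ℕ; NonZero)
open import Data.Nat.Primality using (Prime)
open import Data.Nat.Coprimality using (Coprime)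
open import Data.Vec.Functional using (Vector)
open import Relation.Binary.Structures using (IsDecEquivalence)
import Data.Nat.Properties as ℕₚ
import Relation.Binary.PropositionalEquality as ≡
open import Data.Sum using (inj₁; inj₂)

module NatSum where

  open import Data.Nat
  open import Data.Nat.Properties
  open import Data.Nat.DivMod using (_%_; %-distribˡ-+; m%n%n≡m%n)
  open import Data.Fin using (Fin; zero; suc)
  open import Relation.Binary.PropositionalEquality
  open import Relation.Nullary using (yes; no; contradiction)
  open import Algebra.Definitions.RawMonoid +-0-rawMonoid public using () renaming (sum to sumℕ)
  open import Algebra.Properties.CommutativeMonoid.Sum +-0-commutativeMonoid using (∑-distrib-+)
  open import Algebra.Properties.Monoid.Sum +-0-monoid public using () renaming (sum-cong-≗ to sumℕ-cong)

  private variable k : ℕ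

  sumℕ-mono-≤ : {f g : Fin k → ℕ} → (∀ i → f i ≤ g i) → sumℕ f ≤ sumℕ g
  sumℕ-mono-≤ {zero}  le = z≤n
  sumℕ-mono-≤ {suc k} le = +-mono-≤ (le zero) (sumℕ-mono-≤ (λ i → le (suc i)))

  sumℕ-const : ∀ k c → sumℕ {k} (λ _ → c) ≡ k * c
  sumℕ-const zero    c = refl
  sumℕ-const (suc k) c = cong (c +_) (sumℕ-const k c)

  sumℕ-≤-* : ∀ {m} (f : Fin k → ℕ) → (∀ i → f i ≤ m) → sumℕ f ≤ k * m
  sumℕ-≤-* {k} {m} f le = ≤-trans (sumℕ-mono-≤ le) (≤-reflexive (sumℕ-const k m))

  sumℕ-+-const : ∀ (f : Fin k → ℕ) c → sumℕ (λ i → f i + c) ≡ sumℕ f + k * c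
  sumℕ-+-const {k} f c = trans (∑-distrib-+ f (λ _ → c)) (cong (sumℕ f +_) (sumℕ-const k c))

  sumℕ-≡⇒≗ : (f g : Fin k → ℕ) → (∀ i → f i ≤ g i) → sumℕ f ≡ sumℕ g → ∀ i → f i ≡ g i
  sumℕ-≡⇒≗ {suc k} f g f≤g eq i with f zero ≟ g zero
  ... | no f₀≢g₀ = contradiction eq (<⇒≢ (+-mono-<-≤ (≤∧≢⇒< (f≤g zero) f₀≢g₀) (sumℕ-mono-≤ (λ i → f≤g (suc i)))))
  ... | yes f₀≡g₀ with i
  ...   | zero  = f₀≡g₀
  ...   | suc i = sumℕ-≡⇒≗ (λ i → f (suc i)) (λ i → g (suc i)) (λ i → f≤g (suc i))
                    (+-cancelˡ-≡ (f zero) _ _ (trans eq (cong (_+ _) (sym f₀≡g₀)))) i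

  %-sumℕ : ∀ p .{{_ : NonZero p}} (f : Fin k → ℕ) → sumℕ (λ i → f i % p) % p ≡ sumℕ f % p
  %-sumℕ {zero}  p f = refl
  %-sumℕ {suc k} p f = begin
    (f zero % p + sumℕ (λ i → f (suc i) % p)) % p        ≡⟨ %-distribˡ-+ (f zero % p) _ p ⟩
    (f zero % p % p + sumℕ (λ i → f (suc i) % p) % p) % p
      ≡⟨ cong₂ (λ a b → (a + b) % p) (m%n%n≡m%n (f zero) p) (%-sumℕ p (λ i → f (suc i))) ⟩
    (f zero % p + sumℕ (λ i → f (suc i)) % p) % p        ≡⟨ %-distribˡ-+ (f zero) _ p ⟨
    (f zero + sumℕ (λ i → f (suc i))) % p                ∎
    where open ≡-Reasoning

module ListCounting where

  open import Data.Nat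
  open import Data.Nat.Properties
  open import Data.Fin as Fin using (Fin; zero; suc)
  open import Data.Fin.Properties using (all?; any?)
  open import Data.List as List using (List; []; _∷_; length; filter; upTo; _++_; cartesianProductWith)
  open import Data.List.Properties using (length-++; length-map; length-tabulate; filter-accept; filter-none)
  open import Data.List.Membership.Propositional using (_∈_)
  open import Data.List.Membership.Propositional.Properties
  open import Data.List.Relation.Unary.Any using (here; there)
  open import Data.List.Relation.Unary.All as All using (All)
  open import Data.List.Relation.Unary.AllPairs using ([]; _∷_)
  open import Data.List.Relation.Unary.Unique.Propositional using (Unique)
  import Data.List.Relation.Unary.Unique.Propositional.Properties as Unique
  open import Data.Vec as Vec using (Vec)
  open import Data.Vec.Properties using (∷-injective)
  open import Data.Product using (∃; _×_; _,_; proj₁; proj₂)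
  open import Data.Sum using (_⊎_; inj₁; inj₂)
  open import Function using (_∘_)
  open import Level using (Level)
  open import Relation.Binary.PropositionalEquality
  open import Relation.Nullary using (¬_; yes; no; ¬?; contradiction)
  open import Relation.Nullary.Decidable using (decidable-stable)
  open import Relation.Unary using (Pred; Decidable)
  open NatSum

  private variable
    a b : Level
    X Y Z : Set a

  private
    ∈-remove : ∀ {y : Y} (ys : List Y) → y ∈ ys →
      ∃ λ ys′ → length ys ≡ suc (length ys′) × (∀ {z} → z ∈ ys → z ≢ y → z ∈ ys′)
    ∈-remove ys y∈ys with us , vs , refl ← ∈-∃++ y∈ys =
      us ++ vs , length-removed , keep
      where
      length-removed : length (us ++ _ ∷ vs) ≡ suc (length (us ++ vs))
      length-removed = trans (length-++ us) (trans (+-suc (length us) (length vs)) (cong suc (sym (length-++ us))))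
      keep : ∀ {z} → z ∈ us ++ _ ∷ vs → z ≢ _ → z ∈ us ++ vs
      keep z∈ z≢y with ∈-++⁻ us z∈
      ... | inj₁ z∈us         = ∈-++⁺ˡ z∈us
      ... | inj₂ (here z≡y)   = contradiction z≡y z≢y
      ... | inj₂ (there z∈vs) = ∈-++⁺ʳ us z∈vs

  length-≤-injection : (f : X → Y) {xs : List X} {ys : List Y} → Unique xs →
    (∀ {x} → x ∈ xs → f x ∈ ys) →
    (∀ {x x′} → x ∈ xs → x′ ∈ xs → f x ≡ f x′ → x ≡ x′) →
    length xs ≤ length ys
  length-≤-injection f {[]}     _          _    _   = z≤n
  length-≤-injection f {x ∷ xs} (x∉ ∷ xs!) maps inj
    with ys′ , length-ys , keep ← ∈-remove _ (maps (here refl)) rewrite length-ys =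
    s≤s (length-≤-injection f xs! maps′ (λ p q → inj (there p) (there q)))
    where
    maps′ : ∀ {x′} → x′ ∈ xs → f x′ ∈ ys′
    maps′ x′∈ = keep (maps (there x′∈)) (λ fx′≡fx → All.lookup x∉ x′∈ (sym (inj (there x′∈) (here refl) fx′≡fx)))

  ∈-length≤1⇒≡ : {xs : List X} {x x′ : X} → length xs ≤ 1 → x ∈ xs → x′ ∈ xs → x ≡ x′
  ∈-length≤1⇒≡ {xs = _ ∷ []}    _        (here refl) (here refl) = refl
  ∈-length≤1⇒≡ {xs = _ ∷ _ ∷ _} (s≤s ()) _           _

  length-cartesianProductWith : (f : X → Y → Z) (xs : List X) (ys : List Y) →
    length (cartesianProductWith f xs ys) ≡ length xs * length ys
  length-cartesianProductWith f []       ys = refl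
  length-cartesianProductWith f (x ∷ xs) ys =
    trans (length-++ (List.map (f x) ys)) (cong₂ _+_ (length-map (f x) ys) (length-cartesianProductWith f xs ys))

  vectors : List X → (q : ℕ) → List (Vec X q)
  vectors xs zero    = Vec.[] ∷ []
  vectors xs (suc q) = cartesianProductWith Vec._∷_ xs (vectors xs q)

  length-vectors : (xs : List X) (q : ℕ) → length (vectors xs q) ≡ length xs ^ q
  length-vectors xs zero    = refl
  length-vectors xs (suc q) = trans (length-cartesianProductWith Vec._∷_ xs (vectors xs q)) (cong (length xs *_) (length-vectors xs q))

  ∈-vectors : {xs : List X} {q : ℕ} (v : Vec X q) → (∀ i → Vec.lookup v i ∈ xs) → v ∈ vectors xs q
  ∈-vectors Vec.[]       _  = here refl
  ∈-vectors (x Vec.∷ v) ∈xs = ∈-cartesianProductWith⁺ Vec._∷_ (∈xs zero) (∈-vectors v (∈xs ∘ suc))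

  length-vectors-allFin : ∀ p q → length (vectors (List.allFin p) q) ≡ p ^ q
  length-vectors-allFin p q = trans (length-vectors (List.allFin p) q) (cong (_^ q) (length-tabulate {n = p} (λ i → i)))

  ∈-vectors-allFin : ∀ {p q} (v : Vec (Fin p) q) → v ∈ vectors (List.allFin p) q
  ∈-vectors-allFin v = ∈-vectors v (λ i → ∈-allFin (Vec.lookup v i))

  vectors-unique : {xs : List X} → Unique xs → (q : ℕ) → Unique (vectors xs q)
  vectors-unique xs! zero    = All.[] ∷ []
  vectors-unique xs! (suc q) = Unique.cartesianProductWith⁺ Vec._∷_ ∷-injective xs! (vectors-unique xs! q)

  module _ {P Q R : Pred X 0ℓ} (P? : Decidable P) (Q? : Decidable Q) (R? : Decidable R) where

    private
      length-filter-∷ : {S : Pred X 0ℓ} (S? : Decidable S) (x : X) (xs : List X) →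
        length (filter S? xs) ≤ length (filter S? (x ∷ xs))
      length-filter-∷ S? x xs with S? x
      ... | yes _ = n≤1+n _
      ... | no  _ = ≤-refl

    length-filter-⊆-∪ : (∀ x → P x → Q x ⊎ R x) → ∀ xs →
      length (filter P? xs) ≤ length (filter Q? xs) + length (filter R? xs)
    length-filter-⊆-∪ P⊆Q∪R []       = z≤n
    length-filter-⊆-∪ P⊆Q∪R (x ∷ xs) with ih ← length-filter-⊆-∪ P⊆Q∪R xs | P? x
    ... | no _ = ≤-trans ih (+-mono-≤ (length-filter-∷ Q? x xs) (length-filter-∷ R? x xs))
    ... | yes px with P⊆Q∪R x px
    ...   | inj₁ qx rewrite filter-accept Q? {xs = xs} qx =
      s≤s (≤-trans ih (+-monoʳ-≤ _ (length-filter-∷ R? x xs)))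
    ...   | inj₂ rx rewrite filter-accept R? {xs = xs} rx =
      ≤-trans (s≤s (≤-trans ih (+-monoˡ-≤ _ (length-filter-∷ Q? x xs)))) (≤-reflexive (sym (+-suc _ _)))

  length-filter-any-≤-sumℕ : ∀ {k} {Q : Fin k → Pred X 0ℓ} (Q? : ∀ j → Decidable (Q j)) xs →
    length (filter (λ x → any? (λ j → Q? j x)) xs) ≤ sumℕ (λ j → length (filter (Q? j) xs))
  length-filter-any-≤-sumℕ {k = zero} Q? xs =
    ≤-reflexive (cong length (filter-none (λ x → any? (λ j → Q? j x)) (All.universal (λ _ ()) xs)))
  length-filter-any-≤-sumℕ {k = suc k} {Q} Q? xs =
    ≤-trans (length-filter-⊆-∪ _ (Q? zero) (λ x → any? (λ j → Q? (suc j) x)) split xs)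
            (+-monoʳ-≤ _ (length-filter-any-≤-sumℕ (Q? ∘ suc) xs))
    where
    split : ∀ x → ∃ (λ j → Q j x) → Q zero x ⊎ ∃ (λ j → Q (suc j) x)
    split x (zero  , q) = inj₁ q
    split x (suc j , q) = inj₂ (j , q)

  length-filter-∘-≤ : ∀ {Q : Pred ℕ 0ℓ} (Q? : Decidable Q) (g : ℕ → ℕ) {N T} →
    (∀ x → x < N → g x < T) →
    (∀ x x′ → x < N → x′ < N → g x ≡ g x′ → x ≡ x′) →
    length (filter (Q? ∘ g) (upTo N)) ≤ length (filter Q? (upTo T))
  length-filter-∘-≤ Q? g {N} {T} g< g-inj =
    length-≤-injection g (Unique.filter⁺ (Q? ∘ g) (Unique.upTo⁺ N)) maps
      (λ p q → g-inj _ _ (bound p) (bound q))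
    where
    bound : ∀ {x} → x ∈ filter (Q? ∘ g) (upTo N) → x < N
    bound p = ∈-upTo⁻ (proj₁ (∈-filter⁻ (Q? ∘ g) {xs = upTo N} p))
    maps : ∀ {x} → x ∈ filter (Q? ∘ g) (upTo N) → g x ∈ filter Q? (upTo T)
    maps p = ∈-filter⁺ Q? (∈-upTo⁺ (g< _ (bound p))) (proj₂ (∈-filter⁻ (Q? ∘ g) {xs = upTo N} p))

  length-upTo-≤-all-+ : ∀ {P : Pred ℕ 0ℓ} (P? : Decidable P) {q N T m} (g : Fin q → ℕ → ℕ) →
    (∀ j x → x < N → g j x < T) →
    (∀ j x x′ → x < N → x′ < N → g j x ≡ g j x′ → x ≡ x′) →
    length (filter (¬? ∘ P?) (upTo T)) ≤ m →
    N ≤ length (filter (λ x → all? (λ j → P? (g j x))) (upTo N)) + q * m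
  length-upTo-≤-all-+ {P} P? {q} {N} {T} {m} g g< g-inj bad≤m = begin
    N                                                      ≡⟨ length-upTo N ⟨
    length (upTo N)                                        ≡⟨ cong length (filter-all ⊤? (All.universal _ (upTo N))) ⟨
    length (filter ⊤? (upTo N))                            ≤⟨ length-filter-⊆-∪ ⊤? All? Any? split (upTo N) ⟩
    length (filter All? (upTo N)) + length (filter Any? (upTo N))
      ≤⟨ +-monoʳ-≤ _ (length-filter-any-≤-sumℕ (λ j → ¬? ∘ P? ∘ g j) (upTo N)) ⟩
    length (filter All? (upTo N)) + sumℕ (λ j → length (filter (¬? ∘ P? ∘ g j) (upTo N)))
      ≤⟨ +-monoʳ-≤ _ (sumℕ-≤-* _ (λ j → ≤-trans (length-filter-∘-≤ (¬? ∘ P?) (g j) (g< j) (g-inj j)) bad≤m)) ⟩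
    length (filter All? (upTo N)) + q * m                 ∎
    where
    open ≤-Reasoning
    open import Data.List.Properties using (length-upTo; filter-all)
    open import Data.Unit using (⊤; tt)
    ⊤? : Decidable (λ (_ : ℕ) → ⊤)
    ⊤? _ = yes tt
    All? : Decidable (λ x → ∀ j → P (g j x))
    All? x = all? (λ j → P? (g j x))
    Any? : Decidable (λ x → ∃ λ j → ¬ P (g j x))
    Any? x = any? (λ j → ¬? (P? (g j x)))
    split : ∀ x → ⊤ → (∀ j → P (g j x)) ⊎ ∃ (λ j → ¬ P (g j x))
    split x _ with Any? x
    ... | yes bad = inj₂ bad
    ... | no ¬bad = inj₁ (λ j → decidable-stable (P? (g j x)) (λ ¬p → ¬bad (j , ¬p)))

module Carries (p : ℕ) .{{_ : NonZero p}} where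

  open import Data.Nat
  open import Data.Nat.Properties
  open import Data.Nat.DivMod
  open import Data.Nat.Divisibility
  open import Data.Nat.Coprimality using (Coprime; coprime-divisor) renaming (sym to ⊥-sym)
  open import Data.Nat.Tactic.RingSolver using (solve-∀)
  open import Algebra.Properties.CommutativeSemigroup +-commutativeSemigroup using (xy∙z≈xz∙y; x∙yz≈xz∙y)
  open import Data.Fin using (Fin; toℕ; fromℕ<)
  open import Data.Fin.Properties using (toℕ-fromℕ<)
  open import Data.Vec.Functional using (_∷_)
  open import Data.Product using (_,_)
  open import Relation.Binary.PropositionalEquality
  open import Relation.Nullary using (contradiction)
  open NatSum

  infixl 7 _/p^_
  _/p^_ : ℕ → ℕ → ℕ
  z /p^ j = (z / p ^ j) {{m^n≢0 p j}}

  digitAt : ℕ → ℕ → ℕ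
  digitAt j z = z /p^ j % p

  digitSum : ∀ {r} → ℕ → ℕ → ℕ → (Fin r → ℕ) → ℕ
  digitSum j a b zs = digitAt j a + (digitAt j b + sumℕ (λ i → digitAt j (zs i)))

  private
    digitSum-% : ∀ {r} j a b (zs : Fin r → ℕ) →
      digitSum j a b zs % p ≡ (a /p^ j + (b /p^ j + sumℕ (λ i → zs i /p^ j))) % p
    digitSum-% j a b zs = %-sumℕ p (λ i → (a ∷ b ∷ zs) i /p^ j)

    [m+n]%d≡m%d⇒d∣n : ∀ m n d .{{_ : NonZero d}} → (m + n) % d ≡ m % d → d ∣ n
    [m+n]%d≡m%d⇒d∣n m n d eq = divides ((m % d + n) / d) (+-cancelˡ-≡ (m % d) _ _ (begin
      m % d + n                                 ≡⟨ m≡m%n+[m/n]*n (m % d + n) d ⟩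
      (m % d + n) % d + (m % d + n) / d * d     ≡⟨ cong (_+ (m % d + n) / d * d) [m%d+n]%d≡m%d ⟩
      m % d + (m % d + n) / d * d               ∎))
      where
      open ≡-Reasoning
      [m%d+n]%d≡m%d : (m % d + n) % d ≡ m % d
      [m%d+n]%d≡m%d = begin
        (m % d + n) % d           ≡⟨ %-distribˡ-+ (m % d) n d ⟩
        (m % d % d + n % d) % d   ≡⟨ cong (λ u → (u + n % d) % d) (m%n%n≡m%n m d) ⟩
        (m % d + n % d) % d       ≡⟨ %-distribˡ-+ m n d ⟨
        (m + n) % d               ≡⟨ eq ⟩
        m % d                     ∎

    ∣∧<⇒≡0 : ∀ {m n} → m ∣ n → n < m → n ≡ 0
    ∣∧<⇒≡0 {n = zero}  _   _   = refl
    ∣∧<⇒≡0 {n = suc n} m∣n n<m = contradiction (∣⇒≤ m∣n) (<⇒≱ n<m)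

    [m+k*n]/n≡m/n+k : ∀ m k n .{{_ : NonZero n}} → (m + k * n) / n ≡ m / n + k
    [m+k*n]/n≡m/n+k m k n = trans (+-distrib-/-∣ʳ m (divides k refl)) (cong (m / n +_) (m*n/n≡m k n))

  -- With x′ = x + δ and every ys′ i = ys i + δ, a balanced j-th digit forces
  -- p^(j+1) ∣ δ once p^j ∣ δ: the quotients by p^j of the r + 1 numbers x′, ys′ i
  -- all exceed their counterparts by δ / p^j, against a single such excess on the
  -- other side, so p ∣ r · δ / p^j.
  private
    module Shifted {r} (r⊥p : Coprime r p) (n x δ : ℕ) (ys ys′ : Fin r → ℕ)
      (ys′≡ : ∀ i → ys′ i ≡ ys i + δ)
      (balanced : ∀ (j : Fin n) → digitSum (toℕ j) (x + 1) (x + δ) ys′ % p ≡ digitSum (toℕ j) (x + δ + 1) x ys % p) where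

      balanced′ : ∀ j → j < n → digitSum j (x + 1) (x + δ) ys′ % p ≡ digitSum j (x + δ + 1) x ys % p
      balanced′ j j<n = subst (λ i → digitSum i (x + 1) (x + δ) ys′ % p ≡ digitSum i (x + δ + 1) x ys % p)
                              (toℕ-fromℕ< j<n) (balanced (fromℕ< j<n))

      p^j∣δ : ∀ j → j ≤ n → p ^ j ∣ δ
      p^j∣δ zero    _   = 1∣ δ
      p^j∣δ (suc j) j<n with divides k δ≡k*M ← p^j∣δ j (<⇒≤ j<n) =
        subst (p * M ∣_) (sym δ≡k*M) (*-monoˡ-∣ M p∣k)
        where
        open ≡-Reasoning
        M : ℕ
        M = p ^ j
        instance
          M≢0 : NonZero M
          M≢0 = m^n≢0 p j
        a b Y : ℕ
        a = (x + 1) / M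
        b = x / M
        Y = sumℕ (λ i → ys i / M)
        shift : ∀ z → (z + δ) / M ≡ z / M + k
        shift z = trans (cong (λ d → (z + d) / M) δ≡k*M) ([m+k*n]/n≡m/n+k z k M)
        Σys′ : sumℕ (λ i → ys′ i / M) ≡ Y + r * k
        Σys′ = trans (sumℕ-cong (λ i → trans (cong (_/ M) (ys′≡ i)) (shift (ys i)))) (sumℕ-+-const (λ i → ys i / M) k)
        rearrange : ∀ a b k Y rk → a + ((b + k) + (Y + rk)) ≡ (a + k + (b + Y)) + rk
        rearrange = solve-∀
        left : (x + 1) / M + ((x + δ) / M + sumℕ (λ i → ys′ i / M)) ≡ (a + k + (b + Y)) + r * k
        left = begin
          a + ((x + δ) / M + sumℕ (λ i → ys′ i / M))  ≡⟨ cong₂ (λ u v → a + (u + v)) (shift x) Σys′ ⟩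
          a + ((b + k) + (Y + r * k))                 ≡⟨ rearrange a b k Y (r * k) ⟩
          (a + k + (b + Y)) + r * k                   ∎
        right : (x + δ + 1) / M + (x / M + sumℕ (λ i → ys i / M)) ≡ a + k + (b + Y)
        right = cong (_+ (b + Y)) (trans (cong (_/ M) (xy∙z≈xz∙y x δ 1)) (shift (x + 1)))
        p∣k : p ∣ k
        p∣k = coprime-divisor (⊥-sym r⊥p) ([m+n]%d≡m%d⇒d∣n (a + k + (b + Y)) (r * k) p (begin
          ((a + k + (b + Y)) + r * k) % p                                  ≡⟨ cong (_% p) left ⟨
          ((x + 1) / M + ((x + δ) / M + sumℕ (λ i → ys′ i / M))) % p       ≡⟨ digitSum-% j (x + 1) (x + δ) ys′ ⟨
          digitSum j (x + 1) (x + δ) ys′ % p                               ≡⟨ balanced′ j j<n ⟩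
          digitSum j (x + δ + 1) x ys % p                                  ≡⟨ digitSum-% j (x + δ + 1) x ys ⟩
          ((x + δ + 1) / M + (x / M + sumℕ (λ i → ys i / M))) % p          ≡⟨ cong (_% p) right ⟩
          (a + k + (b + Y)) % p                                            ∎))

      δ≡0 : x + δ < p ^ n → δ ≡ 0
      δ≡0 x+δ<p^n = ∣∧<⇒≡0 (p^j∣δ n ≤-refl) (≤-<-trans (m≤n+m δ x) x+δ<p^n)

    ≤∧balanced-digits⇒≡ : ∀ {r} → Coprime r p → ∀ n {x x′} (ys ys′ : Fin r → ℕ) →
      x ≤ x′ → x′ < p ^ n → (∀ i → ys i + x′ ≡ ys′ i + x) →
      (∀ (j : Fin n) → digitSum (toℕ j) (x + 1) x′ ys′ % p ≡ digitSum (toℕ j) (x′ + 1) x ys % p) →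
      x ≡ x′
    ≤∧balanced-digits⇒≡ r⊥p n {x} ys ys′ x≤x′ x′<p^n ys∼ys′ balanced
      with δ , refl ← m≤n⇒∃[o]m+o≡n x≤x′ =
      sym (trans (cong (x +_) (Shifted.δ≡0 r⊥p n x δ ys ys′ ys′≡ balanced x′<p^n)) (+-identityʳ x))
      where
      ys′≡ : ∀ i → ys′ i ≡ ys i + δ
      ys′≡ i = +-cancelʳ-≡ x (ys′ i) (ys i + δ) (trans (sym (ys∼ys′ i)) (x∙yz≈xz∙y (ys i) x δ))

  balanced-digits⇒≡ : ∀ {r} → Coprime r p → ∀ n {x x′} (ys ys′ : Fin r → ℕ) →
    x < p ^ n → x′ < p ^ n → (∀ i → ys i + x′ ≡ ys′ i + x) →
    (∀ (j : Fin n) → digitSum (toℕ j) (x + 1) x′ ys′ % p ≡ digitSum (toℕ j) (x′ + 1) x ys % p) →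
    x ≡ x′
  balanced-digits⇒≡ r⊥p n {x} {x′} ys ys′ x<p^n x′<p^n ys∼ys′ balanced with ≤-total x x′
  ... | inj₁ x≤x′ = ≤∧balanced-digits⇒≡ r⊥p n ys ys′ x≤x′ x′<p^n ys∼ys′ balanced
  ... | inj₂ x′≤x = sym (≤∧balanced-digits⇒≡ r⊥p n ys′ ys x′≤x x<p^n (λ i → sym (ys∼ys′ i)) (λ j → sym (balanced j)))

module Wraparound (T : ℕ) .{{_ : NonZero T}} where

  open import Data.Nat
  open import Data.Nat.Properties
  open import Data.Nat.DivMod using (_%_; _/_; m≡m%n+[m/n]*n; m<n*o⇒m/o<n)
  open import Relation.Binary.PropositionalEquality
  open import Algebra.Properties.CommutativeSemigroup +-commutativeSemigroup using (xy∙z≈xz∙y; xy∙z≈zy∙x)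

  [x+e]/T≤1 : ∀ {x e} → x < T → e < T → (x + e) / T ≤ 1
  [x+e]/T≤1 x<T e<T = s≤s⁻¹ (m<n*o⇒m/o<n (<-≤-trans (+-mono-< x<T e<T) (≤-reflexive (cong (T +_) (sym (+-identityʳ T))))))

  [x+e]/T≡⇒[x+e]%T+x′≡ : ∀ {x x′ e} → (x + e) / T ≡ (x′ + e) / T → (x + e) % T + x′ ≡ (x′ + e) % T + x
  [x+e]/T≡⇒[x+e]%T+x′≡ {x} {x′} {e} q≡q′ = +-cancelʳ-≡ (q * T) _ _ (begin
    (x + e) % T + x′ + q * T         ≡⟨ xy∙z≈xz∙y ((x + e) % T) x′ (q * T) ⟩
    (x + e) % T + q * T + x′         ≡⟨ cong (_+ x′) (m≡m%n+[m/n]*n (x + e) T) ⟨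
    x + e + x′                       ≡⟨ xy∙z≈zy∙x x e x′ ⟩
    x′ + e + x                       ≡⟨ cong (_+ x) (m≡m%n+[m/n]*n (x′ + e) T) ⟩
    (x′ + e) % T + q′ * T + x        ≡⟨ cong (λ t → (x′ + e) % T + t * T + x) q≡q′ ⟨
    (x′ + e) % T + q * T + x         ≡⟨ xy∙z≈xz∙y ((x′ + e) % T) (q * T) x ⟩
    (x′ + e) % T + x + q * T         ∎)
    where
    open ≡-Reasoning
    q q′ : ℕ
    q = (x + e) / T
    q′ = (x′ + e) / T

module PrimeBinomial where

  open import Data.Nat
  open import Data.Nat.Properties
  open import Data.Nat.Divisibility
  open import Data.Nat.Primality using (Prime; euclidsLemma; prime⇒nonTrivial)
  open import Data.Nat.Combinatorics using (_C_; k![n∸k]!∣n!)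
  open import Data.Nat.Combinatorics.Specification using (nCk≡n!/k![n-k]!)
  open import Data.Nat.DivMod using (m/n*n≡m)
  open import Relation.Binary.PropositionalEquality
  open import Relation.Nullary using (¬_; contradiction)

  prime∤! : ∀ {p} → Prime p → ∀ m → m < p → ¬ (p ∣ m !)
  prime∤! pp zero    _ p∣1 = contradiction (∣1⇒≡1 p∣1) (>⇒≢ (nonTrivial⇒n>1 _ {{prime⇒nonTrivial pp}}))
  prime∤! pp (suc m) m<p p∣m! with euclidsLemma (suc m) (m !) pp p∣m!
  ... | inj₁ p∣1+m = <⇒≱ m<p (∣⇒≤ p∣1+m)
  ... | inj₂ p∣m!  = prime∤! pp m (<-trans (n<1+n m) m<p) p∣m!

  prime∣C : ∀ {p} → Prime p → ∀ k → 0 < k → k < p → p ∣ p C k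
  prime∣C {zero}         _  _ _   ()
  prime∣C {p@(suc p-1)} pp k 0<k k<p with euclidsLemma (p C k) (k ! * (p ∸ k) !) pp p∣pCk*D
    where
    instance
      D≢0 : NonZero (k ! * (p ∸ k) !)
      D≢0 = k !* (p ∸ k) !≢0
    pCk*D≡p! : (p C k) * (k ! * (p ∸ k) !) ≡ p !
    pCk*D≡p! = trans (cong (_* (k ! * (p ∸ k) !)) (nCk≡n!/k![n-k]! (<⇒≤ k<p))) (m/n*n≡m (k![n∸k]!∣n! (<⇒≤ k<p)))
    p∣p! : p ∣ p !
    p∣p! = divides ((p-1) !) (*-comm p ((p-1) !))
    p∣pCk*D : p ∣ (p C k) * (k ! * (p ∸ k) !)
    p∣pCk*D = subst (p ∣_) (sym pCk*D≡p!) p∣p!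
  ... | inj₁ p∣pCk = p∣pCk
  ... | inj₂ p∣D with euclidsLemma (k !) ((p ∸ k) !) pp p∣D
  ...   | inj₁ p∣k!    = contradiction p∣k! (prime∤! pp k k<p)
  ...   | inj₂ p∣[p∸k]! = contradiction p∣[p∸k]! (prime∤! pp (p ∸ k) (∸-monoʳ-< 0<k (<⇒≤ k<p)))

module Characteristic {c ℓ} (R : CommutativeRing c ℓ) {p : ℕ} where

  open CommutativeRing R
  open import Algebra.Definitions.RawSemiring (Algebra.Bundles.Semiring.rawSemiring semiring)
    using () renaming (_×_ to _·_)
  open import Algebra.Properties.Monoid.Mult +-monoid using (×-congʳ; ×-congˡ; ×-homo-+)
  open import Algebra.Properties.Semiring.Mult semiring using (×-assoc-*; ×1-homo-*)
  open import Data.Nat as ℕ using (_%_; _/_)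
  open import Data.Nat.DivMod using (m≡m%n+[m/n]*n)
  open import Data.Nat.Divisibility using (_∣_; divides; ∣-refl)
  open import Relation.Binary.Reasoning.Setoid setoid

  module _ (char : p · 1# ≈ 0#) where

    ∣⇒·≈0 : ∀ {N} z → p ∣ N → N · z ≈ 0#
    ∣⇒·≈0 z (divides q ≡.refl) = begin
      (q ℕ.* p) · z                ≈⟨ ×-congʳ (q ℕ.* p) (*-identityˡ z) ⟨
      (q ℕ.* p) · (1# * z)         ≈⟨ ×-assoc-* (q ℕ.* p) 1# z ⟨
      ((q ℕ.* p) · 1#) * z         ≈⟨ *-congʳ (×1-homo-* q p) ⟩
      ((q · 1#) * (p · 1#)) * z    ≈⟨ *-congʳ (*-congˡ char) ⟩
      ((q · 1#) * 0#) * z          ≈⟨ *-congʳ (zeroʳ _) ⟩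
      0# * z                       ≈⟨ zeroˡ z ⟩
      0#                           ∎

    p·≈0 : ∀ z → p · z ≈ 0#
    p·≈0 z = ∣⇒·≈0 z ∣-refl

    ·-% : .{{_ : NonZero p}} → ∀ N z → N · z ≈ (N % p) · z
    ·-% N z = begin
      N · z                                ≈⟨ ×-congˡ (m≡m%n+[m/n]*n N p) ⟩
      (N % p ℕ.+ (N / p) ℕ.* p) · z        ≈⟨ ×-homo-+ z (N % p) _ ⟩
      (N % p) · z + ((N / p) ℕ.* p) · z    ≈⟨ +-congˡ (∣⇒·≈0 z (divides (N / p) ≡.refl)) ⟩
      (N % p) · z + 0#                     ≈⟨ +-identityʳ _ ⟩
      (N % p) · z                          ∎

module Frobenius {c ℓ} (R : CommutativeRing c ℓ) {p : ℕ} (p-prime : Prime p) where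

  open CommutativeRing R
  open import Algebra.Definitions.RawSemiring (Algebra.Bundles.Semiring.rawSemiring semiring)
    using (_^_) renaming (_×_ to _·_)
  open import Algebra.Properties.Monoid.Mult +-monoid using (×-homo-1)
  open import Algebra.Properties.Semiring.Exp semiring using (^-congˡ; ^-assocʳ)
  open import Algebra.Properties.Monoid.Sum +-monoid using (sum-init-last; sum-cong-≋; sum-replicate-zero)
  import Algebra.Properties.CommutativeSemiring.Binomial commutativeSemiring as Binomial
  open import Data.Nat as ℕ using (zero; suc)
  open import Data.Nat.Combinatorics using (nCn≡1)
  open import Data.Nat.Properties using (n∸n≡0)
  open import Data.Fin using (Fin; toℕ; fromℕ; inject₁)
  open import Data.Fin.Properties using (toℕ-fromℕ; toℕ-inject₁; toℕ<n)
  open ≡ using (_≡_)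
  open import Relation.Nullary using (contradiction)
  open import Relation.Binary.Reasoning.Setoid setoid
  open PrimeBinomial using (prime∣C)

  module _ (char : p · 1# ≈ 0#) where

    open Characteristic R {p} using (∣⇒·≈0)

    -- In (x + y) ^ p only the outer binomial terms survive, as p divides the others.
    ^p-homo-+ : ∀ x y → (x + y) ^ p ≈ x ^ p + y ^ p
    ^p-homo-+ x y = expand p ≡.refl
      where
      expand : ∀ q → q ≡ p → (x + y) ^ q ≈ x ^ q + y ^ q
      expand zero    ≡.refl = contradiction p-prime (λ ())
      expand (suc k) ≡.refl = begin
        (x + y) ^ suc k                                              ≈⟨ Binomial.theorem (suc k) x y ⟩
        term Fin.zero + sum (λ i → term (Fin.suc i))                 ≈⟨ +-cong first (sum-init-last (λ i → term (Fin.suc i))) ⟩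
        y ^ suc k + (sum (λ i → term (Fin.suc (inject₁ i))) + term (Fin.suc (fromℕ k)))
                                                                     ≈⟨ +-congˡ (+-cong middle last) ⟩
        y ^ suc k + (0# + x ^ suc k)                                 ≈⟨ +-congˡ (+-identityˡ _) ⟩
        y ^ suc k + x ^ suc k                                        ≈⟨ +-comm _ _ ⟩
        x ^ suc k + y ^ suc k                                        ∎
        where
        import Data.Fin as Fin
        open import Algebra.Definitions.RawMonoid +-rawMonoid using (sum)
        term : Fin (suc (suc k)) → Carrier
        term = Binomial.binomialTerm x y (suc k)
        first : term Fin.zero ≈ y ^ suc k
        first = trans (+-identityʳ _) (*-identityˡ _)
        middle : sum (λ i → term (Fin.suc (inject₁ i))) ≈ 0#
        middle = trans (sum-cong-≋ vanishes) (sum-replicate-zero k)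
          where
          vanishes : ∀ i → term (Fin.suc (inject₁ i)) ≈ 0#
          vanishes i = ∣⇒·≈0 char _ (prime∣C p-prime (suc (toℕ (inject₁ i))) (ℕ.s≤s ℕ.z≤n)
                         (ℕ.s≤s (≡.subst (ℕ._< k) (≡.sym (toℕ-inject₁ i)) (toℕ<n i))))
        last : term (Fin.suc (fromℕ k)) ≈ x ^ suc k
        last rewrite toℕ-fromℕ k | nCn≡1 (suc k) | n∸n≡0 k = trans (×-homo-1 _) (*-identityʳ _)

    ^p^j-homo-+ : ∀ j x y → (x + y) ^ (p ℕ.^ j) ≈ x ^ (p ℕ.^ j) + y ^ (p ℕ.^ j)
    ^p^j-homo-+ zero    x y = trans (*-identityʳ _) (+-cong (sym (*-identityʳ x)) (sym (*-identityʳ y)))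
    ^p^j-homo-+ (suc j) x y = begin
      (x + y) ^ (p ℕ.* p ℕ.^ j)                    ≈⟨ ^-assocʳ (x + y) p (p ℕ.^ j) ⟨
      ((x + y) ^ p) ^ (p ℕ.^ j)                    ≈⟨ ^-congˡ (p ℕ.^ j) (^p-homo-+ x y) ⟩
      (x ^ p + y ^ p) ^ (p ℕ.^ j)                  ≈⟨ ^p^j-homo-+ j (x ^ p) (y ^ p) ⟩
      (x ^ p) ^ (p ℕ.^ j) + (y ^ p) ^ (p ℕ.^ j)    ≈⟨ +-cong (^-assocʳ x p _) (^-assocʳ y p _) ⟩
      x ^ (p ℕ.* p ℕ.^ j) + y ^ (p ℕ.* p ℕ.^ j)    ∎

module Linearised (K : CommutativeRing 0ℓ 0ℓ) {p : ℕ} (p-prime : Prime p) (char : FieldDefs.HasChar K p)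
                  {n : ℕ} (c : Vector (CommutativeRing.Carrier K) n) where

  open CommutativeRing K
  open FieldDefs K using (linearised)
  open import Algebra.Definitions.RawSemiring (Algebra.Bundles.Semiring.rawSemiring semiring) using (sum; _^_)
  open import Algebra.Properties.Semiring.Exp semiring using (^-congˡ)
  open import Algebra.Properties.Monoid.Sum +-monoid using (sum-cong-≋)
  open import Algebra.Properties.CommutativeMonoid.Sum +-commutativeMonoid using (∑-distrib-+)
  open import Algebra.Properties.Ring ring using (x+x≈x⇒x≈0)
  open import Data.Nat as ℕ using (zero; suc)
  open import Data.Fin using (Fin; toℕ)
  open Frobenius K p-prime using (^p^j-homo-+)

  private
    term : Carrier → Fin n → Carrier
    term z j = c j * z ^ (p ℕ.^ toℕ j)

  linearised-cong : ∀ {z w} → z ≈ w → linearised p c z ≈ linearised p c w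
  linearised-cong {z} {w} z≈w = sum-cong-≋ {x = term z} {y = term w} (λ j → *-congˡ (^-congˡ (p ℕ.^ toℕ j) z≈w))

  linearised-+ : ∀ z w → linearised p c (z + w) ≈ linearised p c z + linearised p c w
  linearised-+ z w = trans (sum-cong-≋ {x = term (z + w)} {y = λ j → term z j + term w j}
                              (λ j → trans (*-congˡ (^p^j-homo-+ char (toℕ j) z w)) (distribˡ (c j) _ _)))
                           (∑-distrib-+ (term z) (term w))

  linearised-0 : linearised p c 0# ≈ 0#
  linearised-0 = x+x≈x⇒x≈0 _ (sym (trans (linearised-cong (sym (+-identityʳ 0#))) (linearised-+ 0# 0#)))

  linearised-sum : ∀ {k} (f : Fin k → Carrier) → linearised p c (sum f) ≈ sum (λ i → linearised p c (f i))
  linearised-sum {zero}  f = linearised-0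
  linearised-sum {suc k} f = trans (linearised-+ _ _) (+-congˡ (linearised-sum (λ i → f (Fin.suc i))))

module FieldProperties (K : CommutativeRing 0ℓ 0ℓ) (isF : IsDecField K) where

  open CommutativeRing K
  open IsDecField isF
  open import Data.Product using (_,_)
  open import Relation.Nullary using (¬_)
  open import Relation.Binary.Reasoning.Setoid setoid

  *-cancelˡ-≉0 : ∀ {x y z} → ¬ (x ≈ 0#) → x * y ≈ x * z → y ≈ z
  *-cancelˡ-≉0 {x} {y} {z} x≉0 xy≈xz with x⁻¹ , xx⁻¹≈1 ← inverse x x≉0 = begin
    y                ≈⟨ *-identityˡ y ⟨
    1# * y           ≈⟨ *-congʳ (trans (*-comm x⁻¹ x) xx⁻¹≈1) ⟨
    (x⁻¹ * x) * y    ≈⟨ *-assoc x⁻¹ x y ⟩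
    x⁻¹ * (x * y)    ≈⟨ *-congˡ xy≈xz ⟩
    x⁻¹ * (x * z)    ≈⟨ *-assoc x⁻¹ x z ⟨
    (x⁻¹ * x) * z    ≈⟨ *-congʳ (trans (*-comm x⁻¹ x) xx⁻¹≈1) ⟩
    1# * z           ≈⟨ *-identityˡ z ⟩
    z                ∎

module PowersOfOrder (K : CommutativeRing 0ℓ 0ℓ) (isF : IsDecField K)
                     {γ : CommutativeRing.Carrier K} {T : ℕ} (ord : FieldDefs.HasOrder K γ T) where

  open CommutativeRing K
  open IsDecField isF
  open FieldDefs K using (HasOrder)
  open import Algebra.Definitions.RawSemiring (Algebra.Bundles.Semiring.rawSemiring semiring) using (_^_)
  open import Algebra.Properties.Semiring.Exp semiring using (^-congˡ; ^-congʳ; ^-homo-*; ^-assocʳ)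
  open import Data.Nat as ℕ using (suc; _<_; _≤_; _%_; _/_)
  open import Data.Nat.DivMod using (m≡m%n+[m/n]*n)
  open import Data.Product using (_,_; proj₁; proj₂)
  open ≡ using (_≡_)
  open import Relation.Nullary using (¬_; contradiction)
  open import Relation.Binary.Reasoning.Setoid setoid
  open FieldProperties K isF using (*-cancelˡ-≉0)

  instance
    T≢0 : NonZero T
    T≢0 = ℕ.>-nonZero (proj₁ ord)

  ^[q*T]≈1 : ∀ q → γ ^ (q ℕ.* T) ≈ 1#
  ^[q*T]≈1 q = begin
    γ ^ (q ℕ.* T)     ≈⟨ ^-congʳ γ (ℕₚ.*-comm q T) ⟩
    γ ^ (T ℕ.* q)     ≈⟨ ^-assocʳ γ T q ⟨
    (γ ^ T) ^ q       ≈⟨ ^-congˡ q (proj₁ (proj₂ ord)) ⟩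
    1# ^ q            ≈⟨ 1^ q ⟩
    1#                ∎
    where
    1^ : ∀ q → 1# ^ q ≈ 1#
    1^ ℕ.zero    = refl
    1^ (suc q) = trans (*-identityˡ _) (1^ q)

  ^-% : ∀ z → γ ^ z ≈ γ ^ (z % T)
  ^-% z = begin
    γ ^ z                                  ≈⟨ ^-congʳ γ (m≡m%n+[m/n]*n z T) ⟩
    γ ^ (z % T ℕ.+ (z / T) ℕ.* T)            ≈⟨ ^-homo-* γ (z % T) _ ⟩
    γ ^ (z % T) * γ ^ ((z / T) ℕ.* T)      ≈⟨ *-congˡ (^[q*T]≈1 (z / T)) ⟩
    γ ^ (z % T) * 1#                       ≈⟨ *-identityʳ _ ⟩
    γ ^ (z % T)                            ∎

  ^≉0 : ∀ x → ¬ (γ ^ x ≈ 0#)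
  ^≉0 x γ^x≈0 = 1≉0 (begin
    1#              ≈⟨ ^[q*T]≈1 x ⟨
    γ ^ (x ℕ.* T)   ≈⟨ ^-assocʳ γ x T ⟨
    (γ ^ x) ^ T     ≈⟨ ^-congˡ T γ^x≈0 ⟩
    0# ^ T          ≈⟨ 0^ (proj₁ ord) ⟩
    0#              ∎)
    where
    0^ : ∀ {q} → 1 ≤ q → 0# ^ q ≈ 0#
    0^ (ℕ.s≤s _) = zeroˡ _

  private
    ^-injective-≤ : ∀ {x x′} → x ≤ x′ → x′ < T → γ ^ x ≈ γ ^ x′ → x ≡ x′
    ^-injective-≤ {x} x≤x′ x′<T γ^x≈γ^x′ with ℕₚ.m≤n⇒∃[o]m+o≡n x≤x′
    ... | ℕ.zero , ≡.refl = ≡.sym (ℕₚ.+-identityʳ x)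
    ... | suc δ  , ≡.refl = contradiction γ^[1+δ]≈1
                              (proj₂ (proj₂ ord) (suc δ) (ℕ.s≤s ℕ.z≤n) (ℕₚ.≤-<-trans (ℕₚ.m≤n+m (suc δ) x) x′<T))
      where
      γ^[1+δ]≈1 : γ ^ suc δ ≈ 1#
      γ^[1+δ]≈1 = *-cancelˡ-≉0 (^≉0 x) (begin
        γ ^ x * γ ^ suc δ     ≈⟨ ^-homo-* γ x (suc δ) ⟨
        γ ^ (x ℕ.+ suc δ)       ≈⟨ γ^x≈γ^x′ ⟨
        γ ^ x                 ≈⟨ *-identityʳ _ ⟨
        γ ^ x * 1#            ∎)

  ^-injective : ∀ {x x′} → x < T → x′ < T → γ ^ x ≈ γ ^ x′ → x ≡ x′
  ^-injective {x} {x′} x<T x′<T γ^x≈γ^x′ with ℕₚ.≤-total x x′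
  ... | inj₁ x≤x′ = ^-injective-≤ x≤x′ x′<T γ^x≈γ^x′
  ... | inj₂ x′≤x = ≡.sym (^-injective-≤ x′≤x x<T (sym γ^x≈γ^x′))

module SubspaceCongruence (K : CommutativeRing 0ℓ 0ℓ) {p : ℕ} .{{_ : NonZero p}} (char : FieldDefs.HasChar K p)
                          {U : CommutativeRing.Carrier K → Set} (U-subspace : FieldDefs.IsSubspace K p U) where

  open CommutativeRing K renaming (Carrier to A)
  open FieldDefs K using (lin)
  open import Algebra.Definitions.RawSemiring (Algebra.Bundles.Semiring.rawSemiring semiring)
    using (sum) renaming (_×_ to _·_)
  open import Algebra.Properties.AbelianGroup +-abelianGroup using (⁻¹-∙-comm; ⁻¹-anti-homo‿-; inverseˡ-unique)
  open import Algebra.Properties.CommutativeSemigroup +-commutativeSemigroup using (interchange)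
  open import Algebra.Properties.Monoid.Mult +-monoid using (×-congˡ; ×-homo-+; ×-homo-1)
  open import Data.Nat as ℕ using (zero; suc; _∸_; >-nonZero⁻¹)
  open import Data.Nat.Properties using (m∸n+n≡m)
  open import Data.Nat.DivMod using (m%n<n)
  open import Data.Fin as Fin using (Fin; toℕ; fromℕ<)
  open import Data.Fin.Properties using (toℕ-fromℕ<)
  open import Data.Product using (proj₁; proj₂)
  open import Relation.Binary.Reasoning.Setoid setoid
  open Characteristic K {p} using (p·≈0; ·-%)

  U-resp : ∀ {z z′} → z ≈ z′ → U z → U z′
  U-resp = proj₁ U-subspace

  U-0 : U 0#
  U-0 = proj₁ (proj₂ U-subspace)

  U-+ : ∀ {z z′} → U z → U z′ → U (z + z′)
  U-+ = proj₁ (proj₂ (proj₂ U-subspace))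

  U-· : ∀ (a : Fin p) {z} → U z → U (toℕ a · z)
  U-· = proj₂ (proj₂ (proj₂ U-subspace))

  U-sum : ∀ {k} (f : Fin k → A) → (∀ i → U (f i)) → U (sum f)
  U-sum {zero}  f _  = U-0
  U-sum {suc k} f Uf = U-+ (Uf Fin.zero) (U-sum (λ i → f (Fin.suc i)) (λ i → Uf (Fin.suc i)))

  U-lin : ∀ {d} (a : Fin d → Fin p) (u : Vector A d) → (∀ i → U (u i)) → U (lin a u)
  U-lin a u Uu = U-sum _ (λ i → U-· (a i) (Uu i))

  U-·ℕ : ∀ N {z} → U z → U (N · z)
  U-·ℕ N {z} Uz = U-resp (trans (×-congˡ (toℕ-fromℕ< (m%n<n N p))) (sym (·-% char N z))) (U-· (fromℕ< (m%n<n N p)) Uz)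

  U-neg : ∀ {z} → U z → U (- z)
  U-neg {z} Uz = U-resp (inverseˡ-unique _ z [p-1]·z+z≈0) (U-·ℕ (p ∸ 1) Uz)
    where
    [p-1]·z+z≈0 : (p ∸ 1) · z + z ≈ 0#
    [p-1]·z+z≈0 = begin
      (p ∸ 1) · z + z         ≈⟨ +-congˡ (×-homo-1 z) ⟨
      (p ∸ 1) · z + 1 · z     ≈⟨ ×-homo-+ z (p ∸ 1) 1 ⟨
      (p ∸ 1 ℕ.+ 1) · z       ≈⟨ ×-congˡ (m∸n+n≡m (>-nonZero⁻¹ p)) ⟩
      p · z                   ≈⟨ p·≈0 char z ⟩
      0#                      ∎

  infix 4 _~_
  _~_ : A → A → Set
  z ~ w = U (z - w)

  ~-refl : ∀ {z} → z ~ z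
  ~-refl = U-resp (sym (-‿inverseʳ _)) U-0

  ~-sym : ∀ {z w} → z ~ w → w ~ z
  ~-sym {z} {w} z~w = U-resp (⁻¹-anti-homo‿- z w) (U-neg z~w)

  ~-trans : ∀ {z w v} → z ~ w → w ~ v → z ~ v
  ~-trans {z} {w} {v} z~w w~v = U-resp (begin
    (z - w) + (w - v)        ≈⟨ +-assoc z (- w) (w - v) ⟩
    z + (- w + (w - v))      ≈⟨ +-congˡ (+-assoc (- w) w (- v)) ⟨
    z + ((- w + w) - v)      ≈⟨ +-congˡ (+-congʳ (-‿inverseˡ w)) ⟩
    z + (0# - v)             ≈⟨ +-congˡ (+-identityˡ (- v)) ⟩
    z - v                    ∎) (U-+ z~w w~v)

  ~-resp : ∀ {z z′ w w′} → z ≈ z′ → w ≈ w′ → z ~ w → z′ ~ w′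
  ~-resp z≈z′ w≈w′ = U-resp (+-cong z≈z′ (-‿cong w≈w′))

  ~-+ : ∀ {z₁ z₂ w₁ w₂} → z₁ ~ w₁ → z₂ ~ w₂ → z₁ + z₂ ~ w₁ + w₂
  ~-+ {z₁} {z₂} {w₁} {w₂} z₁~w₁ z₂~w₂ = U-resp (begin
    (z₁ - w₁) + (z₂ - w₂)         ≈⟨ interchange z₁ (- w₁) z₂ (- w₂) ⟩
    (z₁ + z₂) + (- w₁ - w₂)       ≈⟨ +-congˡ (⁻¹-∙-comm w₁ w₂) ⟩
    (z₁ + z₂) - (w₁ + w₂)         ∎) (U-+ z₁~w₁ z₂~w₂)

  ~-sum : ∀ {k} (f g : Fin k → A) → (∀ i → f i ~ g i) → sum f ~ sum g
  ~-sum {zero}  f g _   = ~-refl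
  ~-sum {suc k} f g f~g = ~-+ (f~g Fin.zero) (~-sum (λ i → f (Fin.suc i)) (λ i → g (Fin.suc i)) (λ i → f~g (Fin.suc i)))

  +-U⇒~ : ∀ {z z′ u u′} → U u → U u′ → z + u ≈ z′ + u′ → z ~ z′
  +-U⇒~ {z} {z′} {u} {u′} Uu Uu′ z+u≈z′+u′ = U-resp (begin
    u′ - u                          ≈⟨ +-identityˡ _ ⟨
    0# + (u′ - u)                   ≈⟨ +-congʳ (-‿inverseʳ z′) ⟨
    (z′ - z′) + (u′ - u)            ≈⟨ interchange z′ (- z′) u′ (- u) ⟩
    (z′ + u′) + (- z′ - u)          ≈⟨ +-congʳ z+u≈z′+u′ ⟨
    (z + u) + (- z′ - u)            ≈⟨ interchange z u (- z′) (- u) ⟩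
    (z - z′) + (u - u)              ≈⟨ +-congˡ (-‿inverseʳ u) ⟩
    (z - z′) + 0#                   ≈⟨ +-identityʳ _ ⟩
    z - z′                          ∎) (U-+ Uu′ (U-neg Uu))

module LeastRepresentatives {R : ℕ → ℕ → Set}
         (R-isDecEquivalence : IsDecEquivalence R) where

  open IsDecEquivalence R-isDecEquivalence
    renaming (refl to R-refl; sym to R-sym; trans to R-trans; _≟_ to R?)
  open import Data.Nat
  open import Data.Nat.Properties
  open import Data.List using (List; filter; upTo)
  open import Data.List.Membership.Propositional using (_∈_)
  open import Data.List.Membership.Propositional.Properties using (∈-filter⁺; ∈-filter⁻; ∈-upTo⁺)
  open import Data.List.Relation.Unary.Unique.Propositional using (Unique)
  import Data.List.Relation.Unary.Unique.Propositional.Properties as Unique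
  open import Data.Product using (∃; _×_; _,_; proj₁; proj₂)
  open import Data.Sum using (_⊎_; inj₁; inj₂)
  open import Relation.Binary.PropositionalEquality
  open import Relation.Binary.Definitions using (tri<; tri≈; tri>)
  open import Relation.Nullary using (¬_; yes; no; contradiction)

  private
    IsLeast : ℕ → ℕ → Set
    IsLeast t w = R w t × (∀ v → v < w → ¬ R v t)

    search : ∀ t b → (∀ v → v < b → ¬ R v t) ⊎ ∃ λ w → w < b × IsLeast t w
    search t zero = inj₁ (λ _ ())
    search t (suc b) with search t b
    ... | inj₂ (w , w<b , least) = inj₂ (w , m<n⇒m<1+n w<b , least)
    ... | inj₁ none with R? b t
    ...   | yes Rbt = inj₂ (b , n<1+n b , Rbt , none)
    ...   | no ¬Rbt = inj₁ none′
      where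
      none′ : ∀ v → v < suc b → ¬ R v t
      none′ v v<1+b with m<1+n⇒m<n∨m≡n v<1+b
      ... | inj₁ v<b  = none v v<b
      ... | inj₂ refl = ¬Rbt

    least : ∀ t → ∃ λ w → w ≤ t × IsLeast t w
    least t with search t (suc t)
    ... | inj₁ none                  = contradiction R-refl (none t (n<1+n t))
    ... | inj₂ (w , w<1+t , least)   = w , s≤s⁻¹ w<1+t , least

  lead : ℕ → ℕ
  lead t = proj₁ (least t)

  lead-≤ : ∀ t → lead t ≤ t
  lead-≤ t = proj₁ (proj₂ (least t))

  lead-R : ∀ t → R (lead t) t
  lead-R t = proj₁ (proj₂ (proj₂ (least t)))

  private
    lead-minimal : ∀ t v → v < lead t → ¬ R v t
    lead-minimal t = proj₂ (proj₂ (proj₂ (least t)))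

  lead-cong : ∀ {t t′} → R t t′ → lead t ≡ lead t′
  lead-cong {t} {t′} Rtt′ with <-cmp (lead t) (lead t′)
  ... | tri< lt _ _ = contradiction (R-trans (lead-R t) Rtt′) (lead-minimal t′ (lead t) lt)
  ... | tri≈ _ eq _ = eq
  ... | tri> _ _ gt = contradiction (R-trans (lead-R t′) (R-sym Rtt′)) (lead-minimal t (lead t′) gt)

  lead-≡⇒R : ∀ {t t′} → lead t ≡ lead t′ → R t t′
  lead-≡⇒R {t} {t′} eq = R-trans (R-sym (lead-R t)) (subst (λ w → R w t′) (sym eq) (lead-R t′))

  leads : ℕ → List ℕ
  leads T = filter (λ t → lead t ≟ t) (upTo T)

  lead-∈ : ∀ {T t} → t < T → lead t ∈ leads T
  lead-∈ {T} {t} t<T = ∈-filter⁺ (λ t → lead t ≟ t) (∈-upTo⁺ (≤-<-trans (lead-≤ t) t<T)) (lead-cong (lead-R t))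

  leads-unique : ∀ T → Unique (leads T)
  leads-unique T = Unique.filter⁺ (λ t → lead t ≟ t) (Unique.upTo⁺ T)

  ∈-leads-R⇒≡ : ∀ {T t t′} → t ∈ leads T → t′ ∈ leads T → R t t′ → t ≡ t′
  ∈-leads-R⇒≡ {T} t∈ t′∈ Rtt′ =
    trans (sym (proj₂ (∈-filter⁻ (λ t → lead t ≟ t) {xs = upTo T} t∈)))
          (trans (lead-cong Rtt′) (proj₂ (∈-filter⁻ (λ t → lead t ≟ t) {xs = upTo T} t′∈)))

module Coordinates (K : CommutativeRing 0ℓ 0ℓ) {p : ℕ} .{{_ : NonZero p}} (char : FieldDefs.HasChar K p)
                   {n : ℕ} {β : Vector (CommutativeRing.Carrier K) n} (β-basis : FieldDefs.IsBasis K p β) where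

  open CommutativeRing K renaming (Carrier to A)
  open FieldDefs K using (lin)
  open import Algebra.Definitions.RawSemiring (Algebra.Bundles.Semiring.rawSemiring semiring)
    using (sum) renaming (_×_ to _·_)
  open import Algebra.Properties.Monoid.Mult +-monoid using (×-congˡ)
  open import Algebra.Properties.Monoid.Sum +-monoid using (sum-cong-≋)
  open import Data.Nat as ℕ using (_%_; _≤_)
  open import Data.Nat.DivMod using (m%n<n)
  open import Data.Fin using (Fin; toℕ; fromℕ<)
  open import Data.Fin.Properties using (toℕ-fromℕ<)
  open import Data.List using (List; length)
  open import Data.List.Membership.Propositional using (_∈_)
  open import Data.List.Relation.Unary.Unique.Propositional using (Unique)
  open import Data.Vec as Vec using (Vec)
  open import Data.Vec.Properties using (lookup∘tabulate)
  open import Data.Product using (proj₁; proj₂)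
  open import Data.Unit using (tt)
  open ≡ using (_≡_)
  open import Relation.Binary.Reasoning.Setoid setoid
  open ListCounting using (length-≤-injection; length-vectors-allFin; ∈-vectors-allFin)
  open Characteristic K {p} using (·-%)

  lin-cong : ∀ {d} {a b : Fin d → Fin p} (v : Vector A d) → (∀ i → a i ≡ b i) → lin a v ≈ lin b v
  lin-cong v a≗b = sum-cong-≋ (λ i → ×-congˡ (≡.cong toℕ (a≗b i)))

  coordinates : A → Vec (Fin p) n
  coordinates z = Vec.tabulate (proj₁ (proj₂ (proj₂ β-basis) z tt))

  lin-coordinates : ∀ z → lin (Vec.lookup (coordinates z)) β ≈ z
  lin-coordinates z = trans (lin-cong β (lookup∘tabulate _)) (proj₂ (proj₂ (proj₂ β-basis) z tt))

  coordinates-injective : ∀ {z w} → coordinates z ≡ coordinates w → z ≈ w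
  coordinates-injective {z} {w} eq = begin
    z                                       ≈⟨ lin-coordinates z ⟨
    lin (Vec.lookup (coordinates z)) β      ≡⟨ ≡.cong (λ v → lin (Vec.lookup v) β) eq ⟩
    lin (Vec.lookup (coordinates w)) β      ≈⟨ lin-coordinates w ⟩
    w                                       ∎

  length-≤-p^n : ∀ {X : Set} (f : X → A) {xs : List X} → Unique xs →
    (∀ {x x′} → x ∈ xs → x′ ∈ xs → f x ≈ f x′ → x ≡ x′) → length xs ≤ p ℕ.^ n
  length-≤-p^n f {xs} xs! f-inj = ≡.subst (length xs ≤_) (length-vectors-allFin p n)
    (length-≤-injection (coordinates ∘ f) xs! (λ _ → ∈-vectors-allFin _)
      (λ x∈ x′∈ eq → f-inj x∈ x′∈ (coordinates-injective eq)))
    where open import Function using (_∘_)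

  coefficients-% : ∀ (N N′ : Fin n → ℕ) → sum (λ j → N j · β j) ≈ sum (λ j → N′ j · β j) → ∀ j → N j % p ≡ N′ j % p
  coefficients-% N N′ eq j = ≡.trans (≡.sym (toℕ-fromℕ< (m%n<n (N j) p)))
                               (≡.trans (≡.cong (λ a → toℕ (a j)) reduced≡) (toℕ-fromℕ< (m%n<n (N′ j) p)))
    where
    reduce : (Fin n → ℕ) → Fin n → Fin p
    reduce M j = fromℕ< (m%n<n (M j) p)
    lin-reduce : ∀ M → lin (reduce M) β ≈ sum (λ j → M j · β j)
    lin-reduce M = sum-cong-≋ (λ j → trans (×-congˡ (toℕ-fromℕ< (m%n<n (M j) p))) (sym (·-% char (M j) (β j))))
    reduced≡ : reduce N ≡ reduce N′
    reduced≡ = proj₁ (proj₂ β-basis) _ _ (trans (lin-reduce N) (trans eq (sym (lin-reduce N′))))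

module DigitExpansion (K : CommutativeRing 0ℓ 0ℓ) {p : ℕ} .{{_ : NonZero p}} (char : FieldDefs.HasChar K p)
                      {n : ℕ} {β : Vector (CommutativeRing.Carrier K) n} (β-basis : FieldDefs.IsBasis K p β) where

  open CommutativeRing K renaming (Carrier to A)
  open FieldDefs K using (ξ; digit)
  open import Algebra.Definitions.RawSemiring (Algebra.Bundles.Semiring.rawSemiring semiring)
    using (sum) renaming (_×_ to _·_)
  open import Algebra.Properties.Monoid.Mult +-monoid using (×-congˡ; ×-homo-+)
  open import Algebra.Properties.Monoid.Sum +-monoid using (sum-cong-≋)
  open import Algebra.Properties.CommutativeMonoid.Sum +-commutativeMonoid using (∑-distrib-+; ∑-comm)
  open import Data.Nat as ℕ using (zero; suc; _%_; _/_)
  open import Data.Nat.Properties using (m^n≢0)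
  open import Data.Nat.DivMod using (n/1≡n; m/n/o≡m/[n*o])
  open import Data.Fin as Fin using (Fin; toℕ)
  open ≡ using (_≡_)
  open import Relation.Binary.Reasoning.Setoid setoid
  open NatSum using (sumℕ)
  open Carries p using (digitAt; digitSum)
  open Coordinates K char β-basis using (coefficients-%)

  digit≡digitAt : ∀ {q} z (j : Fin q) → digit p z j ≡ digitAt (toℕ j) z
  digit≡digitAt z Fin.zero    = ≡.cong (_% p) (≡.sym (n/1≡n z))
  digit≡digitAt z (Fin.suc j) = ≡.trans (digit≡digitAt (z / p) j)
    (≡.cong (_% p) (m/n/o≡m/[n*o] z p (p ℕ.^ toℕ j) {{_}} {{m^n≢0 p (toℕ j)}} {{m^n≢0 p (suc (toℕ j))}}))

  private
    sum-· : ∀ {k} (f : Fin k → ℕ) z → sum (λ i → f i · z) ≈ sumℕ f · z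
    sum-· {zero}  f z = refl
    sum-· {suc k} f z = trans (+-congˡ (sum-· (λ i → f (Fin.suc i)) z)) (sym (×-homo-+ z (f Fin.zero) _))

    sum-+-· : ∀ (f g : Fin n → ℕ) → sum (λ j → f j · β j) + sum (λ j → g j · β j) ≈ sum (λ j → (f j ℕ.+ g j) · β j)
    sum-+-· f g = trans (sym (∑-distrib-+ (λ j → f j · β j) (λ j → g j · β j))) (sum-cong-≋ (λ j → sym (×-homo-+ (β j) (f j) (g j))))

    D : ℕ → Fin n → ℕ
    D z j = digitAt (toℕ j) z

    ξ-D : ∀ z → ξ p β z ≈ sum (λ j → D z j · β j)
    ξ-D z = sum-cong-≋ {x = λ j → digit p z j · β j} {y = λ j → D z j · β j} (λ j → ×-congˡ (digit≡digitAt z j))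

  ξ-digitSum : ∀ {r} a b (zs : Fin r → ℕ) →
    ξ p β a + (ξ p β b + sum (λ i → ξ p β (zs i))) ≈ sum (λ j → digitSum (toℕ j) a b zs · β j)
  ξ-digitSum a b zs = begin
    ξ p β a + (ξ p β b + sum (λ i → ξ p β (zs i)))
      ≈⟨ +-cong (ξ-D a) (+-cong (ξ-D b) (sum-cong-≋ (λ i → ξ-D (zs i)))) ⟩
    Σ (D a) + (Σ (D b) + sum (λ i → sum (λ j → D (zs i) j · β j)))
      ≈⟨ +-congˡ (+-congˡ (trans (∑-comm (λ i j → D (zs i) j · β j)) (sum-cong-≋ (λ j → sum-· (λ i → D (zs i) j) (β j))))) ⟩
    Σ (D a) + (Σ (D b) + Σ (λ j → sumℕ (λ i → D (zs i) j)))
      ≈⟨ +-congˡ (sum-+-· (D b) _) ⟩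
    Σ (D a) + Σ (λ j → D b j ℕ.+ sumℕ (λ i → D (zs i) j))
      ≈⟨ sum-+-· (D a) _ ⟩
    sum (λ j → digitSum (toℕ j) a b zs · β j) ∎
    where
    Σ : (Fin n → ℕ) → A
    Σ N = sum (λ j → N j · β j)

  ξ-≈⇒digitSum-% : ∀ {r} a b (zs : Fin r → ℕ) a′ b′ (zs′ : Fin r → ℕ) →
    ξ p β a + (ξ p β b + sum (λ i → ξ p β (zs i))) ≈ ξ p β a′ + (ξ p β b′ + sum (λ i → ξ p β (zs′ i))) →
    ∀ (j : Fin n) → digitSum (toℕ j) a b zs % p ≡ digitSum (toℕ j) a′ b′ zs′ % p
  ξ-≈⇒digitSum-% a b zs a′ b′ zs′ eq =
    coefficients-% _ _ (trans (sym (ξ-digitSum a b zs)) (trans eq (ξ-digitSum a′ b′ zs′)))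

module Codimension (K : CommutativeRing 0ℓ 0ℓ) (isF : IsDecField K) {p : ℕ} .{{_ : NonZero p}}
                   (char : FieldDefs.HasChar K p) {n : ℕ} {β : Vector (CommutativeRing.Carrier K) n}
                   (β-basis : FieldDefs.IsBasis K p β) {U : CommutativeRing.Carrier K → Set}
                   (U-subspace : FieldDefs.IsSubspace K p U) {k : ℕ} (codim : FieldDefs.HasCodim K p n k U) where

  open CommutativeRing K renaming (Carrier to A)
  open IsDecField isF using (_≟_)
  open FieldDefs K using (lin; IsBasisOf)
  open import Algebra.Properties.AbelianGroup +-abelianGroup using () renaming (∙-cancelˡ to +-cancelˡ)
  open import Data.Nat as ℕ using (_≤_)
  open import Data.Fin using (Fin)
  open import Data.List using (List; length; allFin; cartesianProduct)
  open import Data.List.Membership.Propositional using (_∈_; lose)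
  open import Data.List.Membership.Propositional.Properties using (∈-cartesianProduct⁻)
  open import Data.List.Relation.Unary.Any as Any using (any?)
  open import Data.List.Relation.Unary.Unique.Propositional using (Unique)
  import Data.List.Relation.Unary.Unique.Propositional.Properties as Unique
  open import Data.Vec as Vec using (Vec)
  open import Data.Vec.Properties using (tabulate∘lookup; lookup∘tabulate)
  open import Data.Product using (_×_; _,_; proj₁; proj₂)
  open ≡ using (_≡_)
  open import Relation.Nullary using (Dec; yes; no)
  open ListCounting using (length-cartesianProductWith; vectors; length-vectors-allFin; ∈-vectors-allFin; vectors-unique)
  open SubspaceCongruence K char U-subspace using (_~_; U-resp; U-lin; +-U⇒~)
  open Coordinates K char β-basis using (lin-cong; length-≤-p^n)

  private
    d : ℕ
    d = proj₁ codim
    d+k≡n : d ℕ.+ k ≡ n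
    d+k≡n = proj₁ (proj₂ codim)
    u : Vector A d
    u = proj₁ (proj₂ (proj₂ codim))
    u-basis : IsBasisOf p U u
    u-basis = proj₂ (proj₂ (proj₂ codim))

    U-coefficients : List (Vec (Fin p) d)
    U-coefficients = vectors (allFin p) d

    lin-u : Vec (Fin p) d → A
    lin-u v = lin (Vec.lookup v) u

    lin-u-injective : ∀ {v v′} → lin-u v ≈ lin-u v′ → v ≡ v′
    lin-u-injective {v} {v′} eq = ≡.trans (≡.sym (tabulate∘lookup v))
      (≡.trans (≡.cong Vec.tabulate (proj₁ (proj₂ u-basis) _ _ eq)) (tabulate∘lookup v′))

  U? : ∀ z → Dec (U z)
  U? z with any? (λ v → lin-u v ≟ z) U-coefficients
  ... | yes found = let v , lin-v≈z = Any.satisfied found in yes (U-resp lin-v≈z (U-lin (Vec.lookup v) u (proj₁ u-basis)))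
  ... | no  none  = no (λ Uz → let a , lin-a≈z = proj₂ (proj₂ u-basis) z Uz in
                          none (lose (∈-vectors-allFin (Vec.tabulate a)) (trans (lin-cong u (lookup∘tabulate a)) lin-a≈z)))

  length-incongruent≤p^k : ∀ {X : Set} (f : X → A) {xs : List X} → Unique xs →
    (∀ {x x′} → x ∈ xs → x′ ∈ xs → f x ~ f x′ → x ≡ x′) → length xs ≤ p ℕ.^ k
  length-incongruent≤p^k {X} f {xs} xs! incongruent = ℕₚ.*-cancelʳ-≤ (length xs) (p ℕ.^ k) (p ℕ.^ d) {{ℕₚ.m^n≢0 p d}} (begin
    length xs ℕ.* p ℕ.^ d                         ≡⟨ ≡.cong (length xs ℕ.*_) (length-vectors-allFin p d) ⟨
    length xs ℕ.* length U-coefficients          ≡⟨ length-cartesianProductWith _,_ xs U-coefficients ⟨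
    length (cartesianProduct xs U-coefficients)
      ≤⟨ length-≤-p^n shifted (Unique.cartesianProduct⁺ xs! (vectors-unique (Unique.allFin⁺ p) d)) shifted-injective ⟩
    p ℕ.^ n                                       ≡⟨ ≡.cong (p ℕ.^_) d+k≡n ⟨
    p ℕ.^ (d ℕ.+ k)                               ≡⟨ ℕₚ.^-distribˡ-+-* p d k ⟩
    p ℕ.^ d ℕ.* p ℕ.^ k                           ≡⟨ ℕₚ.*-comm (p ℕ.^ d) (p ℕ.^ k) ⟩
    p ℕ.^ k ℕ.* p ℕ.^ d                           ∎)
    where
    open ℕₚ.≤-Reasoning
    shifted : X × Vec (Fin p) d → A
    shifted (x , v) = f x + lin-u v
    shifted-injective : ∀ {xv xv′} → xv ∈ cartesianProduct xs U-coefficients → xv′ ∈ cartesianProduct xs U-coefficients →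
                        shifted xv ≈ shifted xv′ → xv ≡ xv′
    shifted-injective {x , v} {x′ , v′} xv∈ xv′∈ eq
      with ≡.refl ← incongruent (proj₁ (∈-cartesianProduct⁻ xs _ xv∈)) (proj₁ (∈-cartesianProduct⁻ xs _ xv′∈))
                      (+-U⇒~ (U-lin (Vec.lookup v) u (proj₁ u-basis)) (U-lin (Vec.lookup v′) u (proj₁ u-basis)) eq)
      = ≡.cong (x ,_) (lin-u-injective (+-cancelˡ (f x) _ _ eq))

module Arithmetic where

  open import Data.Nat
  open import Data.Nat.Properties
  open import Relation.Binary.PropositionalEquality

  m∸1≤l+k*n⇒m∸o*n∸1≤l : ∀ m n {k o l} → m ∸ 1 ≤ l + k * n → k ≤ o → m ∸ o * n ∸ 1 ≤ l
  m∸1≤l+k*n⇒m∸o*n∸1≤l m n {k} {o} {l} m∸1≤l+k*n k≤o = begin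
    m ∸ o * n ∸ 1     ≡⟨ ∸-+-assoc m (o * n) 1 ⟩
    m ∸ (o * n + 1)   ≡⟨ cong (m ∸_) (+-comm (o * n) 1) ⟩
    m ∸ (1 + o * n)   ≡⟨ ∸-+-assoc m 1 (o * n) ⟨
    m ∸ 1 ∸ o * n     ≤⟨ ∸-monoʳ-≤ (m ∸ 1) (*-monoˡ-≤ n k≤o) ⟩
    m ∸ 1 ∸ k * n     ≤⟨ m≤n+o⇒m∸n≤o (m ∸ 1) (k * n) (subst (m ∸ 1 ≤_) (+-comm l (k * n)) m∸1≤l+k*n) ⟩
    l                 ∎
    where open ≤-Reasoning

module _ (K : CommutativeRing 0ℓ 0ℓ) (isF : IsDecField K) where

  open CommutativeRing K renaming (Carrier to A)
  open FieldDefs K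
  open IsDecField isF

  module Setting
    (p : ℕ) .{{_ : NonZero p}} (p-prime : Prime p) (n : ℕ) (char : HasChar p)
    (β : Vector A n) (β-basis : IsBasis p β) (γ : A) (T : ℕ) (ord : HasOrder γ T)
    (m : ℕ) (F : A → A) (few-disagreements : disagreements _≟_ p β F γ T ℕ.≤ m)
    (U : A → Set) (k : ℕ) (U-subspace : IsSubspace p U) (codim : HasCodim p n k U)
    (c : Vector A n) (a : A → A) (a-const : ∀ z z′ → U (z - z′) → a z ≈ a z′)
    (F≈M+a : ∀ z → F z ≈ linearised p c z + a z)
    (r : ℕ) (r⊥p : Coprime r p) (γ-1∈rG : InSumset r γ T (γ - 1#)) where

    open import Algebra.Definitions.RawSemiring (Algebra.Bundles.Semiring.rawSemiring semiring) using (sum; _^_)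
    open import Algebra.Properties.Semiring.Exp semiring using (^-homo-*)
    open import Algebra.Properties.Semiring.Sum semiring using (*-distribˡ-sum)
    open import Algebra.Properties.Monoid.Sum +-monoid using (sum-cong-≋)
    open import Algebra.Properties.CommutativeMonoid.Sum +-commutativeMonoid using (∑-distrib-+)
    open import Algebra.Properties.AbelianGroup +-abelianGroup using () renaming (∙-cancelʳ to +-cancelʳ)
    open import Algebra.Solver.CommutativeMonoid +-commutativeMonoid using (solve; _⊕_; _⊜_)
    open import Algebra.Properties.CommutativeSemigroup +-commutativeSemigroup using (interchange; x∙yz≈y∙xz)
    open import Data.Nat as ℕ using (zero; suc; _<_; _≤_; _∸_; _%_; _/_)
    open import Data.Nat.DivMod using (m%n<n; /-monoˡ-≤)
    open import Data.Fin as Fin using (Fin; toℕ)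
    open import Data.Fin.Properties using (all?; toℕ<n)
    open import Data.List as List using (List; length; filter; upTo; cartesianProduct)
    open import Data.List.Properties using (length-upTo)
    open import Data.List.Membership.Propositional using (_∈_)
    open import Data.List.Membership.Propositional.Properties using (∈-filter⁻; ∈-upTo⁺; ∈-upTo⁻; ∈-cartesianProduct⁺)
    import Data.List.Relation.Unary.Unique.Propositional.Properties as Unique
    open import Data.Vec as Vec using (Vec)
    open import Data.Vec.Properties using (lookup∘tabulate)
    open import Data.Product using (_×_; _,_; proj₁; proj₂)
    open import Relation.Nullary using (Dec)
    open ≡ using (_≡_)
    open import Relation.Binary.Reasoning.Setoid setoid
    open NatSum using (sumℕ; sumℕ-≤-*; sumℕ-≡⇒≗)
    open ListCounting using (length-≤-injection; length-upTo-≤-all-+; length-cartesianProductWith; vectors; length-vectors; ∈-vectors)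
    open SubspaceCongruence K char U-subspace using (_~_; ~-refl; ~-sym; ~-trans; ~-resp; ~-+; ~-sum)
    open Codimension K isF char β-basis U-subspace codim using (U?; length-incongruent≤p^k)
    open Coordinates K char β-basis using (length-≤-p^n)
    open DigitExpansion K char β-basis using (ξ-≈⇒digitSum-%)
    open Linearised K p-prime char c using (linearised-cong; linearised-+; linearised-sum)
    open PowersOfOrder K isF ord using (T≢0; ^-%; ^≉0; ^-injective)
    open FieldProperties K isF using (*-cancelˡ-≉0)
    open Carries p using (balanced-digits⇒≡)
    open Wraparound T using ([x+e]/T≤1; [x+e]/T≡⇒[x+e]%T+x′≡)

    N : ℕ
    N = T ∸ 1

    x<N⇒x<T : ∀ {x} → x < N → x < T
    x<N⇒x<T x<N = ℕₚ.<-≤-trans x<N (ℕₚ.m∸n≤m T 1)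

    x<N⇒1+x<T : ∀ {x} → x < N → x ℕ.+ 1 < T
    x<N⇒1+x<T {x} x<N = ℕₚ.m≤o∸n⇒m+n≤o (suc x) (proj₁ ord) x<N

    e : Fin r → ℕ
    e i = toℕ (proj₁ γ-1∈rG i)

    y : Fin r → ℕ → ℕ
    y i x = (x ℕ.+ e i) % T

    γ^x*γ^e≈γ^y : ∀ i x → γ ^ x * γ ^ e i ≈ γ ^ y i x
    γ^x*γ^e≈γ^y i x = trans (sym (^-homo-* γ x (e i))) (^-% (x ℕ.+ e i))

    γ^[x+1] : ∀ x → γ ^ (x ℕ.+ 1) ≈ γ ^ x + sum (λ i → γ ^ y i x)
    γ^[x+1] x = begin
      γ ^ (x ℕ.+ 1)                              ≈⟨ ^-homo-* γ x 1 ⟩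
      γ ^ x * (γ * 1#)                           ≈⟨ *-congˡ (*-identityʳ γ) ⟩
      γ ^ x * γ                                  ≈⟨ *-congˡ γ≈1+[γ-1] ⟩
      γ ^ x * (1# + (γ - 1#))                    ≈⟨ distribˡ (γ ^ x) 1# (γ - 1#) ⟩
      γ ^ x * 1# + γ ^ x * (γ - 1#)              ≈⟨ +-cong (*-identityʳ _) (*-congˡ (proj₂ γ-1∈rG)) ⟩
      γ ^ x + γ ^ x * sum (λ i → γ ^ e i)        ≈⟨ +-congˡ (*-distribˡ-sum (γ ^ x) (λ i → γ ^ e i)) ⟩
      γ ^ x + sum (λ i → γ ^ x * γ ^ e i)        ≈⟨ +-congˡ (sum-cong-≋ (λ i → γ^x*γ^e≈γ^y i x)) ⟩
      γ ^ x + sum (λ i → γ ^ y i x)              ∎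
      where
      γ≈1+[γ-1] : γ ≈ 1# + (γ - 1#)
      γ≈1+[γ-1] = sym (begin
        1# + (γ - 1#)       ≈⟨ x∙yz≈y∙xz 1# γ (- 1#) ⟩
        γ + (1# - 1#)       ≈⟨ +-congˡ (-‿inverseʳ 1#) ⟩
        γ + 0#              ≈⟨ +-identityʳ γ ⟩
        γ                   ∎)

    shifts : Fin (suc r) → ℕ → ℕ
    shifts Fin.zero    x = x
    shifts (Fin.suc i) x = y i x

    points : Fin (2 ℕ.+ r) → ℕ → ℕ
    points Fin.zero    x = x ℕ.+ 1
    points (Fin.suc j) x = shifts j x

    Agrees : ℕ → Set
    Agrees t = F (γ ^ t) ≈ ξ p β t

    Agrees? : ∀ t → Dec (Agrees t)
    Agrees? t = F (γ ^ t) ≟ ξ p β t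

    Good : ℕ → Set
    Good x = ∀ j → Agrees (points j x)

    goods : List ℕ
    goods = filter (λ x → all? (λ j → Agrees? (points j x))) (upTo N)

    ∈-goods⁻ : ∀ {x} → x ∈ goods → x < N × Good x
    ∈-goods⁻ x∈ = let x∈upTo , good = ∈-filter⁻ (λ x → all? (λ j → Agrees? (points j x))) {xs = upTo N} x∈
                  in ∈-upTo⁻ x∈upTo , good

    N≤goods+ : N ≤ length goods ℕ.+ (2 ℕ.+ r) ℕ.* m
    N≤goods+ = length-upTo-≤-all-+ Agrees? points points<T points-injective few-disagreements
      where
      points<T : ∀ j x → x < N → points j x < T
      points<T Fin.zero              x x<N = x<N⇒1+x<T x<N
      points<T (Fin.suc Fin.zero)    x x<N = x<N⇒x<T x<N
      points<T (Fin.suc (Fin.suc i)) x _   = m%n<n _ T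
      points-injective : ∀ j x x′ → x < N → x′ < N → points j x ≡ points j x′ → x ≡ x′
      points-injective Fin.zero              x x′ _   _    eq = ℕₚ.+-cancelʳ-≡ 1 x x′ eq
      points-injective (Fin.suc Fin.zero)    x x′ _   _    eq = eq
      points-injective (Fin.suc (Fin.suc i)) x x′ x<N x′<N eq =
        ^-injective (x<N⇒x<T x<N) (x<N⇒x<T x′<N) (*-cancelˡ-≉0 (^≉0 (e i)) (begin
          γ ^ e i * γ ^ x      ≈⟨ *-comm _ _ ⟩
          γ ^ x * γ ^ e i      ≈⟨ γ^x*γ^e≈γ^y i x ⟩
          γ ^ y i x            ≡⟨ ≡.cong (γ ^_) eq ⟩
          γ ^ y i x′           ≈⟨ γ^x*γ^e≈γ^y i x′ ⟨
          γ ^ x′ * γ ^ e i     ≈⟨ *-comm _ _ ⟩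
          γ ^ e i * γ ^ x′     ∎))

    private
      M : A → A
      M = linearised p c

      agrees⇒ξ≈ : ∀ {t} → Agrees t → ξ p β t ≈ M (γ ^ t) + a (γ ^ t)
      agrees⇒ξ≈ {t} agrees = trans (sym agrees) (F≈M+a (γ ^ t))

      cross : ∀ {u v u′ v′ s t} → u + s ≈ v + t → u′ + s ≈ v′ + t → u + v′ ≈ u′ + v
      cross {u} {v} {u′} {v′} {s} {t} u+s≈v+t u′+s≈v′+t = +-cancelʳ (s + t) (u + v′) (u′ + v) (begin
        (u + v′) + (s + t)      ≈⟨ interchange u v′ s t ⟩
        (u + s) + (v′ + t)      ≈⟨ +-congʳ u+s≈v+t ⟩
        (v + t) + (v′ + t)      ≈⟨ +-comm _ _ ⟩
        (v′ + t) + (v + t)      ≈⟨ +-congʳ u′+s≈v′+t ⟨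
        (u′ + s) + (v + t)      ≈⟨ interchange u′ s v t ⟩
        (u′ + v) + (s + t)      ∎)

    -- Additivity of M turns γ^(x+1) = γ^x + Σ γ^(y i x) into a relation between ξ-values
    -- in which a only enters through its values on the cosets of γ^x, γ^(y i x) and γ^(x+1).
    good⇒ξ-step : ∀ {x} → Good x →
      ξ p β (x ℕ.+ 1) + (a (γ ^ x) + sum (λ i → a (γ ^ y i x))) ≈ (ξ p β x + sum (λ i → ξ p β (y i x))) + a (γ ^ (x ℕ.+ 1))
    good⇒ξ-step {x} good = begin
      ξ p β (x ℕ.+ 1) + (a (γ ^ x) + Σa)                    ≈⟨ +-congʳ (agrees⇒ξ≈ (good Fin.zero)) ⟩
      (M (γ ^ (x ℕ.+ 1)) + a₁) + (a (γ ^ x) + Σa)           ≈⟨ +-congʳ (+-congʳ M-step) ⟩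
      ((M (γ ^ x) + ΣM) + a₁) + (a (γ ^ x) + Σa)
        ≈⟨ solve 5 (λ m Σm a₁ a₀ Σa → ((m ⊕ Σm) ⊕ a₁) ⊕ (a₀ ⊕ Σa) ⊜ ((m ⊕ a₀) ⊕ (Σm ⊕ Σa)) ⊕ a₁) refl (M (γ ^ x)) ΣM a₁ (a (γ ^ x)) Σa ⟩
      ((M (γ ^ x) + a (γ ^ x)) + (ΣM + Σa)) + a₁
        ≈⟨ +-congʳ (+-cong (sym (agrees⇒ξ≈ (good (Fin.suc Fin.zero)))) (sym Σξ≈)) ⟩
      (ξ p β x + sum (λ i → ξ p β (y i x))) + a₁            ∎
      where
      a₁ Σa ΣM : A
      a₁ = a (γ ^ (x ℕ.+ 1))
      Σa = sum (λ i → a (γ ^ y i x))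
      ΣM = sum (λ i → M (γ ^ y i x))
      M-step : M (γ ^ (x ℕ.+ 1)) ≈ M (γ ^ x) + ΣM
      M-step = trans (linearised-cong (γ^[x+1] x)) (trans (linearised-+ _ _) (+-congˡ (linearised-sum (λ i → γ ^ y i x))))
      Σξ≈ : sum (λ i → ξ p β (y i x)) ≈ ΣM + Σa
      Σξ≈ = trans (sum-cong-≋ (λ i → agrees⇒ξ≈ (good (Fin.suc (Fin.suc i)))))
                  (∑-distrib-+ (λ i → M (γ ^ y i x)) (λ i → a (γ ^ y i x)))

    congruent-goods⇒ξ-balanced : ∀ {x x′} → Good x → Good x′ → (∀ j → γ ^ shifts j x ~ γ ^ shifts j x′) →
      ξ p β (x ℕ.+ 1) + (ξ p β x′ + sum (λ i → ξ p β (y i x′)))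
        ≈ ξ p β (x′ ℕ.+ 1) + (ξ p β x + sum (λ i → ξ p β (y i x)))
    congruent-goods⇒ξ-balanced {x} {x′} good good′ congruent =
      cross (good⇒ξ-step good) (trans (+-congˡ same-a) (trans (good⇒ξ-step good′) (+-congˡ (sym same-a₁))))
      where
      same-a : a (γ ^ x) + sum (λ i → a (γ ^ y i x)) ≈ a (γ ^ x′) + sum (λ i → a (γ ^ y i x′))
      same-a = +-cong (a-const _ _ (congruent Fin.zero)) (sum-cong-≋ (λ i → a-const _ _ (congruent (Fin.suc i))))
      same-a₁ : a (γ ^ (x ℕ.+ 1)) ≈ a (γ ^ (x′ ℕ.+ 1))
      same-a₁ = a-const _ _ (~-resp (sym (γ^[x+1] x)) (sym (γ^[x+1] x′))
                  (~-+ (congruent Fin.zero) (~-sum _ _ (λ i → congruent (Fin.suc i)))))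

    carry : Fin r → ℕ → ℕ
    carry i x = (x ℕ.+ e i) / T

    carries : ℕ → ℕ
    carries x = sumℕ (λ i → carry i x)

    carries≤r : ∀ {x} → x < T → carries x ≤ r
    carries≤r {x} x<T = ℕₚ.≤-trans (sumℕ-≤-* _ (λ i → [x+e]/T≤1 x<T (toℕ<n (proj₁ γ-1∈rG i))))
                                   (ℕₚ.≤-reflexive (ℕₚ.*-identityʳ r))

    -- Each carry is monotone in x, so equal totals force equal carries.
    carries-≡⇒carry-≡ : ∀ {x x′} → carries x ≡ carries x′ → ∀ i → carry i x ≡ carry i x′
    carries-≡⇒carry-≡ {x} {x′} eq with ℕₚ.≤-total x x′
    ... | inj₁ x≤x′ = sumℕ-≡⇒≗ _ _ (λ i → /-monoˡ-≤ T (ℕₚ.+-monoˡ-≤ (e i) x≤x′)) eq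
    ... | inj₂ x′≤x = λ i → ≡.sym (sumℕ-≡⇒≗ _ _ (λ i → /-monoˡ-≤ T (ℕₚ.+-monoˡ-≤ (e i) x′≤x)) (≡.sym eq) i)

    _≈ᵉ_ : ℕ → ℕ → Set
    s ≈ᵉ t = γ ^ s ~ γ ^ t

    ≈ᵉ-isDecEquivalence : IsDecEquivalence _≈ᵉ_
    ≈ᵉ-isDecEquivalence = record
      { isEquivalence = record { refl = ~-refl ; sym = ~-sym ; trans = ~-trans }
      ; _≟_           = λ s t → U? (γ ^ s - γ ^ t)
      }

    open LeastRepresentatives ≈ᵉ-isDecEquivalence public using (lead; lead-∈; lead-≡⇒R; leads; leads-unique; ∈-leads-R⇒≡)

    length-leads≤p^k : length (leads T) ≤ p ℕ.^ k
    length-leads≤p^k = length-incongruent≤p^k (γ ^_) (leads-unique T) (∈-leads-R⇒≡ {T})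

    T≤p^n : T ≤ p ℕ.^ n
    T≤p^n = ≡.subst (_≤ p ℕ.^ n) (length-upTo T)
      (length-≤-p^n (γ ^_) (Unique.upTo⁺ T) (λ t∈ t′∈ → ^-injective (∈-upTo⁻ t∈) (∈-upTo⁻ t′∈)))

    signature : ℕ → ℕ × Vec ℕ (suc r)
    signature x = carries x , Vec.tabulate (λ j → lead (shifts j x))

    signature-injective : ∀ {x x′} → x ∈ goods → x′ ∈ goods → signature x ≡ signature x′ → x ≡ x′
    signature-injective {x} {x′} x∈ x′∈ same =
      balanced-digits⇒≡ r⊥p n (λ i → y i x) (λ i → y i x′) (x<p^n x∈) (x<p^n x′∈) y-shift
        (ξ-≈⇒digitSum-% (x ℕ.+ 1) x′ (λ i → y i x′) (x′ ℕ.+ 1) x (λ i → y i x)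
          (congruent-goods⇒ξ-balanced (proj₂ (∈-goods⁻ x∈)) (proj₂ (∈-goods⁻ x′∈)) congruent))
      where
      x<p^n : ∀ {x} → x ∈ goods → x < p ℕ.^ n
      x<p^n x∈ = ℕₚ.<-≤-trans (x<N⇒x<T (proj₁ (∈-goods⁻ x∈))) T≤p^n
      y-shift : ∀ i → y i x ℕ.+ x′ ≡ y i x′ ℕ.+ x
      y-shift i = [x+e]/T≡⇒[x+e]%T+x′≡ (carries-≡⇒carry-≡ (≡.cong proj₁ same) i)
      congruent : ∀ j → γ ^ shifts j x ~ γ ^ shifts j x′
      congruent j = lead-≡⇒R {shifts j x} {shifts j x′} (≡.trans (≡.sym (lookup∘tabulate (λ j → lead (shifts j x)) j))
                      (≡.trans (≡.cong (λ v → Vec.lookup v j) (≡.cong proj₂ same)) (lookup∘tabulate (λ j → lead (shifts j x′)) j)))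

    length-goods≤ : length goods ≤ suc r ℕ.* length (leads T) ℕ.^ suc r
    length-goods≤ = ≡.subst (length goods ≤_) length-signatures
      (length-≤-injection signature (Unique.filter⁺ _ (Unique.upTo⁺ N)) signature-∈ signature-injective)
      where
      signatures : List (ℕ × Vec ℕ (suc r))
      signatures = cartesianProduct (upTo (suc r)) (vectors (leads T) (suc r))
      length-signatures : length signatures ≡ suc r ℕ.* length (leads T) ℕ.^ suc r
      length-signatures = ≡.trans (length-cartesianProductWith _,_ (upTo (suc r)) (vectors (leads T) (suc r)))
                            (≡.cong₂ ℕ._*_ (length-upTo (suc r)) (length-vectors (leads T) (suc r)))
      shifts<T : ∀ j {x} → x < T → shifts j x < T
      shifts<T Fin.zero    x<T = x<T
      shifts<T (Fin.suc i) _   = m%n<n _ T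
      signature-∈ : ∀ {x} → x ∈ goods → signature x ∈ signatures
      signature-∈ {x} x∈ = ∈-cartesianProduct⁺ (∈-upTo⁺ (ℕ.s≤s (carries≤r x<T)))
        (∈-vectors _ (λ j → ≡.subst (_∈ leads T) (≡.sym (lookup∘tabulate (λ j → lead (shifts j x)) j)) (lead-∈ (shifts<T j x<T))))
        where
        x<T : x < T
        x<T = x<N⇒x<T (proj₁ (∈-goods⁻ x∈))

    1≤r : 1 ≤ r
    1≤r = ℕₚ.n≢0⇒n>0 (λ r≡0 → ¬0-coprimeTo-2+ {{prime⇒nonTrivial p-prime}} (≡.subst (λ r → Coprime r p) r≡0 r⊥p))
      where open import Data.Nat.Coprimality using (¬0-coprimeTo-2+)
            open import Data.Nat.Primality using (prime⇒nonTrivial)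

  module OneDimensional
    (p : ℕ) .{{_ : NonZero p}} (p-prime : Prime p) (char : HasChar p)
    (β : Vector A 1) (β-basis : IsBasis p β) (γ : A) (T : ℕ) (ord : HasOrder γ T)
    (m : ℕ) (F : A → A) (few-disagreements : disagreements _≟_ p β F γ T ℕ.≤ m)
    (U : A → Set) (k : ℕ) (U-subspace : IsSubspace p U) (codim : HasCodim p 1 k U)
    (c : Vector A 1) (a : A → A) (a-const : ∀ z z′ → U (z - z′) → a z ≈ a z′)
    (F≈M+a : ∀ z → F z ≈ linearised p c z + a z)
    (r : ℕ) (r⊥p : Coprime r p) (γ-1∈rG : InSumset r γ T (γ - 1#)) where

    open Setting p p-prime 1 char β β-basis γ T ord m F few-disagreements
                 U k U-subspace codim c a a-const F≈M+a r r⊥p γ-1∈rG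
    open import Algebra.Definitions.RawSemiring (Algebra.Bundles.Semiring.rawSemiring semiring) using (_^_) renaming (_×_ to _·_)
    open import Algebra.Properties.Semiring.Exp semiring using (^-homo-*)
    open import Algebra.Properties.Monoid.Mult +-monoid using (×-congˡ; ×-homo-+; ×-homo-1)
    open import Algebra.Properties.AbelianGroup +-abelianGroup using () renaming (∙-cancelʳ to +-cancelʳ)
    open import Algebra.Properties.Ring ring using (x[y-z]≈xy-xz)
    open import Algebra.Solver.CommutativeMonoid +-commutativeMonoid using (solve; _⊕_; _⊜_)
    open import Data.Nat as ℕ using (zero; suc; _<_; _≤_; _∸_)
    open import Data.Nat.DivMod using (m<n⇒m%n≡m)
    open import Data.Fin as Fin using (Fin)
    open import Data.Fin.Properties using (all?; toℕ-fromℕ<)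
    open import Data.Nat.Primality using (prime⇒nonTrivial)
    open import Data.List using (List; []; _∷_; length; filter; upTo)
    open import Data.List.Membership.Propositional using (_∈_)
    open import Data.List.Membership.Propositional.Properties using (∈-filter⁻; ∈-upTo⁻)
    open import Data.List.Relation.Unary.Any using (here)
    import Data.List.Relation.Unary.Unique.Propositional.Properties as Unique
    open import Data.Product using (_×_; _,_; proj₁; proj₂)
    open import Relation.Nullary using (¬_; contradiction)
    open ≡ using (_≡_)
    import Relation.Binary.Reasoning.Setoid setoid as ≈-Reasoning
    open ListCounting using (length-≤-injection; length-upTo-≤-all-+; ∈-length≤1⇒≡)
    open Arithmetic using (m∸1≤l+k*n⇒m∸o*n∸1≤l)
    open SubspaceCongruence K char U-subspace using (_~_)
    open PowersOfOrder K isF ord using (^-injective)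
    open FieldProperties K isF using (*-cancelˡ-≉0)

    private
      β₀ c₀ : A
      β₀ = β Fin.zero
      c₀ = c Fin.zero

      ξ≈·β₀ : ∀ {z} → z < p → ξ p β z ≈ z · β₀
      ξ≈·β₀ z<p = trans (+-identityʳ _) (×-congˡ (m<n⇒m%n≡m z<p))

      M≈c₀* : ∀ z → linearised p c z ≈ c₀ * z
      M≈c₀* z = trans (+-identityʳ _) (*-congˡ (*-identityʳ z))

      β₀≉0 : ¬ (β₀ ≈ 0#)
      β₀≉0 β₀≈0 = contradiction (≡.trans (≡.sym (toℕ-fromℕ< 0<p))
                                 (≡.trans (≡.cong (λ f → Fin.toℕ (f Fin.zero)) same) (toℕ-fromℕ< 1<p))) (λ ())
        where
        open ≈-Reasoning
        1<p : 1 < p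
        1<p = ℕ.nonTrivial⇒n>1 p {{prime⇒nonTrivial p-prime}}
        0<p : 0 < p
        0<p = ℕₚ.<-trans (ℕ.s≤s ℕ.z≤n) 1<p
        same : (λ _ → Fin.fromℕ< 0<p) ≡ (λ _ → Fin.fromℕ< 1<p)
        same = proj₁ (proj₂ β-basis) _ _ (begin
          Fin.toℕ (Fin.fromℕ< 0<p) · β₀ + 0#   ≈⟨ +-identityʳ _ ⟩
          Fin.toℕ (Fin.fromℕ< 0<p) · β₀        ≈⟨ ×-congˡ (toℕ-fromℕ< 0<p) ⟩
          0#                                  ≈⟨ β₀≈0 ⟨
          β₀                                  ≈⟨ ×-homo-1 β₀ ⟨
          1 · β₀                              ≈⟨ ×-congˡ (toℕ-fromℕ< 1<p) ⟨
          Fin.toℕ (Fin.fromℕ< 1<p) · β₀        ≈⟨ +-identityʳ _ ⟨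
          Fin.toℕ (Fin.fromℕ< 1<p) · β₀ + 0#   ∎)

    all-congruent : k ≡ 0 → ∀ {t t′} → t < T → t′ < T → γ ^ t ~ γ ^ t′
    all-congruent k≡0 {t} {t′} t<T t′<T = lead-≡⇒R {t} {t′}
      (∈-length≤1⇒≡ (≡.subst (λ k → length (leads T) ≤ p ℕ.^ k) k≡0 length-leads≤p^k) (lead-∈ t<T) (lead-∈ t′<T))

    consecutive : Fin 2 → ℕ → ℕ
    consecutive Fin.zero    x = x
    consecutive (Fin.suc _) x = x ℕ.+ 1

    pairs : List ℕ
    pairs = filter (λ x → all? (λ j → Agrees? (consecutive j x))) (upTo N)

    N≤pairs+ : N ≤ length pairs ℕ.+ 2 ℕ.* m
    N≤pairs+ = length-upTo-≤-all-+ Agrees? consecutive consecutive<T consecutive-injective few-disagreements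
      where
      consecutive<T : ∀ j x → x < N → consecutive j x < T
      consecutive<T Fin.zero    x x<N = x<N⇒x<T x<N
      consecutive<T (Fin.suc _) x x<N = x<N⇒1+x<T x<N
      consecutive-injective : ∀ j x x′ → x < N → x′ < N → consecutive j x ≡ consecutive j x′ → x ≡ x′
      consecutive-injective Fin.zero    x x′ _ _ eq = eq
      consecutive-injective (Fin.suc _) x x′ _ _ eq = ℕₚ.+-cancelʳ-≡ 1 x x′ eq

    -- For k = 0 the map a is constant on G, while P grows by β₀ from γ^x to γ^(x+1).
    consecutive-agreement : k ≡ 0 → ∀ {x} → x < N → Agrees x → Agrees (x ℕ.+ 1) → (c₀ * γ ^ x) * (γ - 1#) ≈ β₀
    consecutive-agreement k≡0 {x} x<N agrees agrees₁ = begin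
      w * (γ - 1#)        ≈⟨ x[y-z]≈xy-xz w γ 1# ⟩
      w * γ - w * 1#      ≈⟨ +-cong w*γ≈w+β₀ (-‿cong (*-identityʳ w)) ⟩
      (w + β₀) - w        ≈⟨ solve 3 (λ w b -w → (w ⊕ b) ⊕ -w ⊜ b ⊕ (w ⊕ -w)) refl w β₀ (- w) ⟩
      β₀ + (w - w)        ≈⟨ +-congˡ (-‿inverseʳ w) ⟩
      β₀ + 0#             ≈⟨ +-identityʳ β₀ ⟩
      β₀                  ∎
      where
      open ≈-Reasoning
      w : A
      w = c₀ * γ ^ x
      x<p : ∀ {t} → t < T → t < p
      x<p t<T = ℕₚ.<-≤-trans t<T (ℕₚ.≤-trans T≤p^n (ℕₚ.≤-reflexive (ℕₚ.*-identityʳ p)))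
      a-same : a (γ ^ (x ℕ.+ 1)) ≈ a (γ ^ x)
      a-same = a-const _ _ (all-congruent k≡0 (x<N⇒1+x<T x<N) (x<N⇒x<T x<N))
      w*γ≈w+β₀ : w * γ ≈ w + β₀
      w*γ≈w+β₀ = +-cancelʳ (a (γ ^ x)) (w * γ) (w + β₀) (begin
        w * γ + a (γ ^ x)                        ≈⟨ +-cong w*γ≈c₀*γ^[x+1] (sym a-same) ⟩
        c₀ * γ ^ (x ℕ.+ 1) + a (γ ^ (x ℕ.+ 1))   ≈⟨ +-congʳ (M≈c₀* _) ⟨
        linearised p c (γ ^ (x ℕ.+ 1)) + a (γ ^ (x ℕ.+ 1)) ≈⟨ F≈M+a _ ⟨
        F (γ ^ (x ℕ.+ 1))                        ≈⟨ agrees₁ ⟩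
        ξ p β (x ℕ.+ 1)                          ≈⟨ ξ≈·β₀ (x<p (x<N⇒1+x<T x<N)) ⟩
        (x ℕ.+ 1) · β₀                           ≈⟨ ×-homo-+ β₀ x 1 ⟩
        x · β₀ + 1 · β₀                          ≈⟨ +-cong (ξ≈·β₀ (x<p (x<N⇒x<T x<N))) (sym (×-homo-1 β₀)) ⟨
        ξ p β x + β₀                             ≈⟨ +-congʳ agrees ⟨
        F (γ ^ x) + β₀                           ≈⟨ +-congʳ (trans (F≈M+a _) (+-congʳ (M≈c₀* _))) ⟩
        (w + a (γ ^ x)) + β₀                     ≈⟨ solve 3 (λ w a b → (w ⊕ a) ⊕ b ⊜ (w ⊕ b) ⊕ a) refl w (a (γ ^ x)) β₀ ⟩
        (w + β₀) + a (γ ^ x)                     ∎)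
        where
        w*γ≈c₀*γ^[x+1] : w * γ ≈ c₀ * γ ^ (x ℕ.+ 1)
        w*γ≈c₀*γ^[x+1] = trans (*-assoc c₀ (γ ^ x) γ) (*-congˡ (sym (trans (^-homo-* γ x 1) (*-congˡ (*-identityʳ γ)))))

    length-pairs≤1 : k ≡ 0 → length pairs ≤ 1
    length-pairs≤1 k≡0 = length-≤-injection (λ _ → 0) {ys = 0 ∷ []} (Unique.filter⁺ _ (Unique.upTo⁺ N)) (λ _ → here ≡.refl)
      (λ x∈ x′∈ _ → pair-injective (∈-pairs⁻ x∈) (∈-pairs⁻ x′∈))
      where
      ∈-pairs⁻ : ∀ {x} → x ∈ pairs → (c₀ * γ ^ x) * (γ - 1#) ≈ β₀ × x < T
      ∈-pairs⁻ {x} x∈ with x∈upTo , agree ← ∈-filter⁻ (λ x → all? (λ j → Agrees? (consecutive j x))) {xs = upTo N} x∈ =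
        consecutive-agreement k≡0 (∈-upTo⁻ x∈upTo) (agree Fin.zero) (agree (Fin.suc Fin.zero)) , x<N⇒x<T (∈-upTo⁻ x∈upTo)
      pair-injective : ∀ {x x′} → (c₀ * γ ^ x) * (γ - 1#) ≈ β₀ × x < T →
                                  (c₀ * γ ^ x′) * (γ - 1#) ≈ β₀ × x′ < T → x ≡ x′
      pair-injective {x} {x′} (w[γ-1]≈β₀ , x<T) (w′[γ-1]≈β₀ , x′<T) =
        ^-injective x<T x′<T (*-cancelˡ-≉0 c₀≉0 (*-cancelˡ-≉0 γ-1≉0 (begin
          (γ - 1#) * (c₀ * γ ^ x)     ≈⟨ *-comm _ _ ⟩
          (c₀ * γ ^ x) * (γ - 1#)     ≈⟨ w[γ-1]≈β₀ ⟩
          β₀                          ≈⟨ w′[γ-1]≈β₀ ⟨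
          (c₀ * γ ^ x′) * (γ - 1#)    ≈⟨ *-comm _ _ ⟩
          (γ - 1#) * (c₀ * γ ^ x′)    ∎)))
        where
        open ≈-Reasoning
        γ-1≉0 : ¬ (γ - 1# ≈ 0#)
        γ-1≉0 γ-1≈0 = β₀≉0 (trans (sym w[γ-1]≈β₀) (trans (*-congˡ γ-1≈0) (zeroʳ _)))
        c₀≉0 : ¬ (c₀ ≈ 0#)
        c₀≉0 c₀≈0 = β₀≉0 (trans (sym w[γ-1]≈β₀) (trans (*-congʳ (trans (*-congʳ c₀≈0) (zeroˡ _))) (zeroˡ _)))

    private
      k≤1 : k ≤ 1
      k≤1 = ≡.subst (k ≤_) (proj₁ (proj₂ codim)) (ℕₚ.m≤n+m k (proj₁ codim))

      1≤r*1 : 1 ≤ r ℕ.* 1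
      1≤r*1 = ℕₚ.≤-trans 1≤r (ℕₚ.≤-reflexive (≡.sym (ℕₚ.*-identityʳ r)))

      instance
        p^k≢0 : NonZero (p ℕ.^ k)
        p^k≢0 = ℕₚ.m^n≢0 p k
        r*1≢0 : NonZero (r ℕ.* 1)
        r*1≢0 = ℕ.>-nonZero 1≤r*1

    bound : T ∸ (r ℕ.+ 2) ℕ.* m ∸ 1 ≤ r ℕ.* 1 ℕ.* (p ℕ.^ k) ℕ.^ (r ℕ.+ 1)
    bound with ℕₚ.m≤n⇒m<n∨m≡n k≤1
    ... | inj₁ k<1 = begin
      T ∸ (r ℕ.+ 2) ℕ.* m ∸ 1                ≤⟨ m∸1≤l+k*n⇒m∸o*n∸1≤l T m N≤pairs+ (ℕₚ.m≤n+m 2 r) ⟩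
      length pairs                           ≤⟨ length-pairs≤1 (ℕₚ.n<1⇒n≡0 k<1) ⟩
      1                                      ≤⟨ ℕₚ.*-mono-≤ 1≤r*1 (ℕₚ.m^n>0 (p ℕ.^ k) (r ℕ.+ 1)) ⟩
      r ℕ.* 1 ℕ.* (p ℕ.^ k) ℕ.^ (r ℕ.+ 1)    ∎
      where open ℕₚ.≤-Reasoning
    ... | inj₂ k≡1 = begin
      T ∸ (r ℕ.+ 2) ℕ.* m ∸ 1                ≤⟨ ℕₚ.≤-trans (ℕₚ.m∸n≤m _ 1) (ℕₚ.m∸n≤m T ((r ℕ.+ 2) ℕ.* m)) ⟩
      T                                      ≤⟨ T≤p^n ⟩
      p ℕ.^ 1                                ≡⟨ ≡.cong (p ℕ.^_) k≡1 ⟨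
      p ℕ.^ k                                ≡⟨ ℕₚ.*-identityʳ (p ℕ.^ k) ⟨
      (p ℕ.^ k) ℕ.^ 1                        ≤⟨ ℕₚ.^-monoʳ-≤ (p ℕ.^ k) (ℕₚ.m≤n+m 1 r) ⟩
      (p ℕ.^ k) ℕ.^ (r ℕ.+ 1)                ≤⟨ ℕₚ.m≤n*m _ (r ℕ.* 1) ⟩
      r ℕ.* 1 ℕ.* (p ℕ.^ k) ℕ.^ (r ℕ.+ 1)    ∎
      where open ℕₚ.≤-Reasoning

theorem4p4 :
  (K : CommutativeRing 0ℓ 0ℓ) → (isF : IsDecField K) →
  let open CommutativeRing K renaming (Carrier to A)
      open FieldDefs K
      open IsDecField isF
  in
  (p : ℕ) → .{{_ : NonZero p}} → Prime p → (n : ℕ) → 1 ℕ.≤ n →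
  -- A has characteristic p, with ordered F_p-basis β (so |A| = q = p^n)
  HasChar p →
  (β : Vector A n) → IsBasis p β →
  (γ : A) → (T : ℕ) → HasOrder γ T →
  (m : ℕ) → m ℕ.≤ T →
  (F : A → A) → disagreements _≟_ p β F γ T ℕ.≤ m →
  (U : A → Set) → (k : ℕ) → IsSubspace p U → HasCodim p n k U →
  (c : Vector A n) → (a : A → A) →
  (∀ z z′ → U (z - z′) → a z ≈ a z′) →
  (∀ z → F z ≈ linearised p c z + a z) →
  (r : ℕ) → Coprime r p → InSumset r γ T (γ - 1#) →
  (r ℕ.+ 2) ℕ.* m ℕ.< T ℕ.∸ 1 →
  T ℕ.∸ (r ℕ.+ 2) ℕ.* m ℕ.∸ 1 ℕ.≤ r ℕ.* n ℕ.* (p ℕ.^ k) ℕ.^ (r ℕ.+ 1)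
theorem4p4 K isF p p-prime n 1≤n char β β-basis γ T ord m _ F few-disagreements U k U-subspace codim c a a-const F≈M+a r r⊥p γ-1∈rG _
  with ℕₚ.m≤n⇒m<n∨m≡n 1≤n
... | inj₂ ≡.refl = OneDimensional.bound K isF p p-prime char β β-basis γ T ord m F few-disagreements
                                       U k U-subspace codim c a a-const F≈M+a r r⊥p γ-1∈rG
... | inj₁ 2≤n = begin
  T ∸ (r + 2) * m ∸ 1                  ≤⟨ m∸1≤l+k*n⇒m∸o*n∸1≤l T m N≤goods+ (ℕₚ.≤-reflexive (ℕₚ.+-comm 2 r)) ⟩
  length goods                         ≤⟨ length-goods≤ ⟩
  suc r * length (leads T) ^ suc r     ≤⟨ ℕₚ.*-monoʳ-≤ (suc r) (ℕₚ.^-monoˡ-≤ (suc r) length-leads≤p^k) ⟩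
  suc r * (p ^ k) ^ suc r              ≤⟨ ℕₚ.*-monoˡ-≤ ((p ^ k) ^ suc r) 1+r≤r*n ⟩
  r * n * (p ^ k) ^ suc r              ≡⟨ ≡.cong (λ e → r * n * (p ^ k) ^ e) (ℕₚ.+-comm 1 r) ⟩
  r * n * (p ^ k) ^ (r + 1)            ∎
  where
  open import Data.Nat using (suc; _+_; _*_; _^_; _∸_; _≤_)
  open import Data.List using (length)
  open Arithmetic using (m∸1≤l+k*n⇒m∸o*n∸1≤l)
  open Setting K isF p p-prime n char β β-basis γ T ord m F few-disagreements
               U k U-subspace codim c a a-const F≈M+a r r⊥p γ-1∈rG
  open ℕₚ.≤-Reasoning
  1+r≤r*n : suc r ≤ r * n
  1+r≤r*n = begin
    1 + r        ≤⟨ ℕₚ.+-monoˡ-≤ r 1≤r ⟩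
    r + r        ≡⟨ ≡.cong (r +_) (ℕₚ.+-identityʳ r) ⟨
    2 * r        ≡⟨ ℕₚ.*-comm 2 r ⟩
    r * 2        ≤⟨ ℕₚ.*-monoʳ-≤ r 2≤n ⟩
    r * n        ∎
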